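{- Let $\mathcal{C}$ and $\mathcal{D}$ be complexity classes (classes of languages over a finite alphabet $\Sigma$). If $C$ is $\leq_m^p$-complete for $\mathcal{C}$ and $D$ is $\leq_m^p$-complete for $\mathcal{D}$, then $C \tilde{\Delta} D$ is $\leq_m^p$-hard for $\mathcal{C}\, \mathbf{\Delta}\, \mathcal{D}$.
   Context: $\leq_m^p$ denotes polynomial-time many-one reducibility. For sets $C, D$, the symmetric difference is $C \Delta D = (C - D)\cup(D - C)$. For classes $\mathcal{C},\mathcal{D}$, $\mathcal{C}\,\mathbf{\Delta}\,\mathcal{D} = \{L \mid (\exists C\in\mathcal{C})(\exists D\in\mathcal{D})[L = C\Delta D]\}$. For sets $C, D$, $C\tilde{\Delta} D = \{\langle x,y\rangle \mid x\in C \Leftrightarrow y\notin D\}$, where $\langle\cdot,\cdot\rangle$ is a standard polynomial-time computable and invertible pairing function. -}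

module Defs where

open import Data.Nat using (ℕ; zero; suc; _+_; _*_; _^_)
open import Data.Fin using (Fin; zero; suc; _≟_)
open import Data.Bool using (Bool; true; false; _xor_; if_then_else_)
open import Data.List using (List; []; _∷_; _++_; concatMap; length; map)
open import Data.Maybe using (Maybe; just; nothing)
import Data.Maybe as Maybe
open import Data.Sum using (_⊎_; inj₁; inj₂)
open import Data.Product using (Σ; _×_; _,_)
import Data.Product as Prod
open import Relation.Nullary using (yes; no)
open import Relation.Binary.PropositionalEquality using (_≡_)

Sym : ℕ → Set
Sym k = Fin (suc (suc k))

Word : ℕ → Set
Word k = List (Sym k)

Lang : ℕ → Set
Lang k = Word k → Bool

Class : ℕ → Set₁
Class k = Lang k → Set

data Move : Set where
  moveL moveR stay : Move

-- Tape alphabet: nothing = blank, inj₁ a = input symbol, inj₂ j = extra work symbol.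
record TM (k : ℕ) : Set where
  field
    nStates : ℕ
    nExtra  : ℕ
    -- state 'zero' is the start state; δ returning nothing means halt.
    δ : Fin (suc nStates) → Maybe (Sym k ⊎ Fin nExtra) →
        Maybe (Fin (suc nStates) × Maybe (Sym k ⊎ Fin nExtra) × Move)

module _ {k : ℕ} (M : TM k) where
  open TM M

  Cell : Set
  Cell = Maybe (Sym k ⊎ Fin nExtra)

  -- left part is stored reversed (nearest cell first)
  record Config : Set where
    constructor config
    field
      state : Fin (suc nStates)
      left  : List Cell
      cur   : Cell
      right : List Cell
  open Config

  applyMove : Move → Config → Config
  applyMove moveR (config q l c [])      = config q (c ∷ l) nothing []
  applyMove moveR (config q l c (r ∷ rs)) = config q (c ∷ l) r rs
  applyMove moveL (config q [] c rs)      = config q [] c rs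
  applyMove moveL (config q (l ∷ ls) c rs) = config q ls l (c ∷ rs)
  applyMove stay  cfg = cfg

  initConfig : Word k → Config
  initConfig []       = config zero [] nothing []
  initConfig (a ∷ as) = config zero [] (just (inj₁ a)) (map (λ b → just (inj₁ b)) as)

  -- output: maximal string of input symbols starting at the head position
  readOut : List Cell → Word k
  readOut (just (inj₁ a) ∷ cs) = a ∷ readOut cs
  readOut _ = []

  exec : ℕ → Config → Maybe (Word k)
  exec n c with δ (state c) (cur c)
  exec n c       | nothing = just (readOut (cur c ∷ right c))
  exec zero c    | just _  = nothing
  exec (suc n) c | just (q , w , m) =
    exec n (applyMove m (config q (left c) w (right c)))

PolyTimeComputable : {k : ℕ} → (Word k → Word k) → Set
PolyTimeComputable {k} f =
  Σ (TM k) λ M → Σ ℕ λ c →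
    ∀ x → exec M (c * length x ^ c + c) (initConfig M x) ≡ just (f x)

_≤ₘᵖ_ : {k : ℕ} → Lang k → Lang k → Set
_≤ₘᵖ_ {k} A B =
  Σ (Word k → Word k) λ f → PolyTimeComputable f × (∀ x → A x ≡ B (f x))

Hard : {k : ℕ} → Class k → Lang k → Set
Hard 𝒞 H = ∀ A → 𝒞 A → A ≤ₘᵖ H

Complete : {k : ℕ} → Class k → Lang k → Set
Complete 𝒞 C = 𝒞 C × Hard 𝒞 C

_Δ_ : {k : ℕ} → Lang k → Lang k → Lang k
(C Δ D) x = C x xor D x

_𝚫_ : {k : ℕ} → Class k → Class k → Class k
_𝚫_ {k} 𝒞 𝒟 L =
  Σ (Lang k) λ C → Σ (Lang k) λ D → 𝒞 C × 𝒟 D × (∀ x → L x ≡ (C Δ D) x)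

⟨_,_⟩ : {k : ℕ} → Word k → Word k → Word k
⟨ x , y ⟩ = concatMap (λ a → a ∷ a ∷ []) x ++ (zero ∷ suc zero ∷ []) ++ y

isSep : {k : ℕ} → Sym k → Sym k → Bool
isSep zero (suc zero) = true
isSep _    _          = false

-- inverse of the pairing function (nothing on strings not of the form ⟨x,y⟩)
unpair : {k : ℕ} → Word k → Maybe (Word k × Word k)
unpair [] = nothing
unpair (a ∷ []) = nothing
unpair (a ∷ b ∷ rest) with a ≟ b
... | yes _ = Maybe.map (Prod.map₁ (a ∷_)) (unpair rest)
... | no _  = if isSep a b then just ([] , rest) else nothing

-- C Δ̃ D = { ⟨x,y⟩ | x ∈ C ⇔ y ∉ D }   (x ∈ C ⇔ y ∉ D  is  C x ≠ D y, i.e. C x xor D y)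
_Δ̃_ : {k : ℕ} → Lang k → Lang k → Lang k
(C Δ̃ D) z with unpair z
... | nothing       = false
... | just (x , y)  = C x xor D y

{-# OPTIONS --safe #-}
-- If f reduces C' to C and g reduces D' to D, then x ↦ ⟨ f x , g x ⟩ reduces C' Δ D' to C Δ̃ D,
-- since ⟨ f x , g x ⟩ ∈ C Δ̃ D holds iff exactly one of f x ∈ C and g x ∈ D does.  All the work is
-- in showing that this map is computable in polynomial time by a single-tape machine.  From machines
-- for f and g we build one whose work symbols are columns of tracks: it copies the input onto the
-- tracks of f and of g, runs the machine for f and then the one for g on its own track, marking where
-- each halts, and then copies the two outputs (every symbol of f x doubled, then 01, then g x) behind
-- the region used so far, walking back to the left end for every symbol.  If the two machines take
-- times A and B on inputs of length n, the used region has length O(n + A + B), so the whole run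
-- takes O((n + A + B)²) steps.
module Submission where

open import Defs
open import Data.Nat using (ℕ; zero; suc; _+_; _*_; _^_; _≤_; _<_; z≤n; s≤s; _∸_; pred; _<?_; _≡ᵇ_)
open import Data.Nat.Properties
import Data.Nat as ℕ
open import Data.Nat.Tactic.RingSolver using (solve-∀)
open import Data.Fin using (Fin; zero; suc; _↑ˡ_; _↑ʳ_; splitAt; combine; remQuot)
open import Data.Fin.Properties using (splitAt-↑ˡ; splitAt-↑ʳ; remQuot-combine)
import Data.Fin as Fin
open import Data.Bool using (Bool; true; false; _xor_)
open import Data.List using (List; []; _∷_; _++_; length; map; concatMap)
open import Data.List.Properties using (++-assoc; length-++; ++-identityʳ)
open import Data.Maybe using (Maybe; just; nothing)
open import Data.Maybe.Properties using (just-injective)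
import Data.Maybe as Maybe
open import Data.Sum using (_⊎_; inj₁; inj₂)
import Data.Sum as Sum
open import Data.Product using (Σ; _×_; _,_; proj₁; proj₂)
import Data.Product as Prod
open import Data.Unit using (⊤; tt)
open import Data.Empty using (⊥; ⊥-elim)
open import Relation.Nullary using (yes; no)
open import Relation.Nullary.Decidable using (dec-true; dec-false)
open import Relation.Binary using (tri<; tri≈; tri>)
open import Relation.Binary.PropositionalEquality
open import Function using (_∘_)

-- Finite types

record Finite (A : Set) : Set where
  field
    size : ℕ
    toFin : A → Fin size
    fromFin : Fin size → A
    fromFin-toFin : ∀ a → fromFin (toFin a) ≡ a
open Finite

Fin-finite : ∀ n → Finite (Fin n)
Fin-finite n = record { size = n ; toFin = λ i → i ; fromFin = λ i → i ; fromFin-toFin = λ _ → refl }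

⊤-finite : Finite ⊤
⊤-finite = record { size = 1 ; toFin = λ _ → zero ; fromFin = λ _ → tt ; fromFin-toFin = λ _ → refl }

retract-finite : ∀ {A B : Set} (to : A → B) (from : B → A) → (∀ a → from (to a) ≡ a) → Finite B → Finite A
retract-finite to from from-to F = record
  { size = size F
  ; toFin = λ a → toFin F (to a)
  ; fromFin = λ i → from (fromFin F i)
  ; fromFin-toFin = λ a → trans (cong from (fromFin-toFin F (to a))) (from-to a) }

Maybe-finite : ∀ {A} → Finite A → Finite (Maybe A)
Maybe-finite {A} F = record { size = suc (size F) ; toFin = to ; fromFin = from ; fromFin-toFin = from-to }
  where
  to : Maybe A → Fin (suc (size F))
  to nothing = zero
  to (just a) = suc (toFin F a)
  from : Fin (suc (size F)) → Maybe A
  from zero = nothing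
  from (suc i) = just (fromFin F i)
  from-to : ∀ a → from (to a) ≡ a
  from-to nothing = refl
  from-to (just a) = cong just (fromFin-toFin F a)

Bool-finite : Finite Bool
Bool-finite = retract-finite toMaybe fromMaybe fromMaybe-toMaybe (Maybe-finite ⊤-finite)
  where
  toMaybe : Bool → Maybe ⊤
  toMaybe false = nothing
  toMaybe true = just tt
  fromMaybe : Maybe ⊤ → Bool
  fromMaybe nothing = false
  fromMaybe (just _) = true
  fromMaybe-toMaybe : ∀ b → fromMaybe (toMaybe b) ≡ b
  fromMaybe-toMaybe false = refl
  fromMaybe-toMaybe true = refl

⊎-finite : ∀ {A B} → Finite A → Finite B → Finite (A ⊎ B)
⊎-finite {A} {B} F G = record { size = size F + size G ; toFin = to ; fromFin = from ; fromFin-toFin = from-to }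
  where
  to : A ⊎ B → Fin (size F + size G)
  to (inj₁ a) = toFin F a ↑ˡ size G
  to (inj₂ b) = size F ↑ʳ toFin G b
  from : Fin (size F + size G) → A ⊎ B
  from i = Sum.map (fromFin F) (fromFin G) (splitAt (size F) i)
  from-to : ∀ a → from (to a) ≡ a
  from-to (inj₁ a) rewrite splitAt-↑ˡ (size F) (toFin F a) (size G) = cong inj₁ (fromFin-toFin F a)
  from-to (inj₂ b) rewrite splitAt-↑ʳ (size F) (size G) (toFin G b) = cong inj₂ (fromFin-toFin G b)

×-finite : ∀ {A B} → Finite A → Finite B → Finite (A × B)
×-finite {A} {B} F G = record { size = size F * size G ; toFin = to ; fromFin = from ; fromFin-toFin = from-to }
  where
  to : A × B → Fin (size F * size G)
  to (a , b) = combine (toFin F a) (toFin G b)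
  from : Fin (size F * size G) → A × B
  from i = Prod.map (fromFin F) (fromFin G) (remQuot (size G) i)
  from-to : ∀ a → from (to a) ≡ a
  from-to (a , b) = trans (cong (Prod.map (fromFin F) (fromFin G)) (remQuot-combine {size F} {size G} (toFin F a) (toFin G b)))
                          (cong₂ _,_ (fromFin-toFin F a) (fromFin-toFin G b))

-- Tapes and runs

Tape : Set → Set
Tape A = ℕ → A

infixl 6 _[_]≔_
_[_]≔_ : ∀ {A} → Tape A → ℕ → A → Tape A
(h [ p ]≔ c) i with i ℕ.≟ p
... | yes _ = c
... | no _ = h i

module _ {A : Set} where
  []≔-same : ∀ (h : Tape A) p c → (h [ p ]≔ c) p ≡ c
  []≔-same h p c with p ℕ.≟ p
  ... | yes _ = refl
  ... | no p≢p = ⊥-elim (p≢p refl)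

  []≔-other : ∀ (h : Tape A) {p} c {i} → i ≢ p → (h [ p ]≔ c) i ≡ h i
  []≔-other h {p} c {i} i≢p with i ℕ.≟ p
  ... | yes i≡p = ⊥-elim (i≢p i≡p)
  ... | no _ = refl

  []≔-self : ∀ (h : Tape A) p → h [ p ]≔ h p ≗ h
  []≔-self h p i with i ℕ.≟ p
  ... | yes refl = refl
  ... | no _ = refl

  []≔-cong : ∀ {h h' : Tape A} p c → h ≗ h' → h [ p ]≔ c ≗ h' [ p ]≔ c
  []≔-cong p c h≗h' i with i ℕ.≟ p
  ... | yes _ = refl
  ... | no _ = h≗h' i

glue : ∀ {A} → ℕ → Tape A → Tape A → Tape A
glue j h h' i with i <? j
... | yes _ = h i
... | no _ = h' i

module _ {A : Set} (j : ℕ) (h h' : Tape A) where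
  glue-< : ∀ {i} → i < j → glue j h h' i ≡ h i
  glue-< {i} i<j with i <? j
  ... | yes _ = refl
  ... | no i≮j = ⊥-elim (i≮j i<j)

  glue-≥ : ∀ {i} → j ≤ i → glue j h h' i ≡ h' i
  glue-≥ {i} j≤i with i <? j
  ... | yes i<j = ⊥-elim (<⇒≱ i<j j≤i)
  ... | no _ = refl

[]≔-preserves : ∀ {A X : Set} (g : A → X) (f : A → A) → (∀ r → g (f r) ≡ g r) →
  ∀ (h : Tape A) q i → g ((h [ q ]≔ f (h q)) i) ≡ g (h i)
[]≔-preserves g f g∘f≗g h q i with i ℕ.≟ q
... | yes refl = g∘f≗g (h i)
... | no _ = refl

flag-write : ∀ {A : Set} (F : ℕ → Bool → A) p → (λ i → F i false) [ p ]≔ F p true ≗ (λ i → F i (i ≡ᵇ p))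
flag-write F p i with i ℕ.≟ p
... | yes refl = cong (F i) (sym (dec-true (i ℕ.≟ i) refl))
... | no i≢p = cong (F i) (sym (dec-false (i ℕ.≟ p) i≢p))

glue-suc : ∀ {A} j (h h' : Tape A) → glue (suc j) h h' ≗ glue j h h' [ j ]≔ h j
glue-suc j h h' i with <-cmp i j
... | tri< i<j _ _ = trans (glue-< (suc j) h h' (≤-trans i<j (n≤1+n j)))
                           (sym (trans ([]≔-other _ _ (<⇒≢ i<j)) (glue-< j h h' i<j)))
... | tri≈ _ refl _ = trans (glue-< (suc j) h h' ≤-refl) (sym ([]≔-same _ i _))
... | tri> _ _ i>j = trans (glue-≥ (suc j) h h' i>j)
                           (sym (trans ([]≔-other _ _ (>⇒≢ i>j)) (glue-≥ j h h' (<⇒≤ i>j))))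

moveHead : Move → ℕ → ℕ
moveHead moveL p = pred p
moveHead moveR p = suc p
moveHead stay p = p

moveHead≤1+ : ∀ m p → moveHead m p ≤ suc p
moveHead≤1+ moveL p = ≤-trans pred[n]≤n (n≤1+n p)
moveHead≤1+ moveR p = ≤-refl
moveHead≤1+ stay p = n≤1+n p

-- Runs s h p s' h' p' n: started in state s on tape h with the head on cell p, the machine step
-- reaches, in exactly n steps, state s' with the head on cell p' and a tape pointwise equal to h'.
module Steps {St Cell : Set} (step : St → Cell → Maybe (St × Cell × Move)) where
  data Runs : St → Tape Cell → ℕ → St → Tape Cell → ℕ → ℕ → Set where
    done : ∀ {s h h' p} → h ≗ h' → Runs s h p s h' p 0
    more : ∀ {s h p s₁ c m s' h' p' n} → step s (h p) ≡ just (s₁ , c , m) →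
           Runs s₁ (h [ p ]≔ c) (moveHead m p) s' h' p' n → Runs s h p s' h' p' (suc n)

  runs-cong : ∀ {s h h₁ p s' h' p' n} → Runs s h p s' h' p' n → h ≗ h₁ → Runs s h₁ p s' h' p' n
  runs-cong (done h≗h') h≗h₁ = done (λ i → trans (sym (h≗h₁ i)) (h≗h' i))
  runs-cong {p = p} (more st r) h≗h₁ =
    more (trans (cong (step _) (sym (h≗h₁ p))) st) (runs-cong r ([]≔-cong _ _ h≗h₁))

  runs-congʳ : ∀ {s h p s' h' h'' p' n} → Runs s h p s' h' p' n → h' ≗ h'' → Runs s h p s' h'' p' n
  runs-congʳ (done h≗h') h'≗h'' = done (λ i → trans (h≗h' i) (h'≗h'' i))
  runs-congʳ (more st r) h'≗h'' = more st (runs-congʳ r h'≗h'')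

  infixr 5 _⨾_
  _⨾_ : ∀ {s h p s₁ h₁ p₁ n s' h' p' n'} → Runs s h p s₁ h₁ p₁ n → Runs s₁ h₁ p₁ s' h' p' n' →
    Runs s h p s' h' p' (n + n')
  done h≗h₁ ⨾ r = runs-cong r (λ i → sym (h≗h₁ i))
  more st r ⨾ r' = more st (r ⨾ r')

  step-runs : ∀ {s h p s' c m} → step s (h p) ≡ just (s' , c , m) → Runs s h p s' (h [ p ]≔ c) (moveHead m p) 1
  step-runs st = more st (done (λ _ → refl))

  stay-runs : ∀ {s h p s'} → step s (h p) ≡ just (s' , h p , stay) → Runs s h p s' h p 1
  stay-runs st = more st (done ([]≔-self _ _))

  sweepRight : ∀ s d p h → (∀ j → j < d → step s (h (p + j)) ≡ just (s , h (p + j) , moveR)) →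
    Runs s h p s h (p + d) d
  sweepRight s zero p h _ rewrite +-identityʳ p = done (λ _ → refl)
  sweepRight s (suc d) p h moves =
    more (subst (λ i → step s (h i) ≡ just (s , h i , moveR)) (+-identityʳ p) (moves 0 (s≤s z≤n)))
      (runs-cong (subst (λ q → Runs s h (suc p) s h q d) (sym (+-suc p d))
        (sweepRight s d (suc p) h λ j j<d →
           subst (λ i → step s (h i) ≡ just (s , h i , moveR)) (+-suc p j) (moves (suc j) (s≤s j<d))))
        (λ i → sym ([]≔-self h p i)))

  sweepLeft : ∀ s d q h → (∀ j → j < d → step s (h (suc (q + j))) ≡ just (s , h (suc (q + j)) , moveL)) →
    Runs s h (q + d) s h q d
  sweepLeft s zero q h _ rewrite +-identityʳ q = done (λ _ → refl)
  sweepLeft s (suc d) q h moves rewrite +-suc q d =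
    more (moves d ≤-refl) (runs-cong (sweepLeft s d q h λ j j<d → moves j (≤-trans j<d (n≤1+n d)))
                                     (λ i → sym ([]≔-self h _ i)))

symbolAt : ∀ {A : Set} → List A → ℕ → Maybe A
symbolAt [] i = nothing
symbolAt (a ∷ x) zero = just a
symbolAt (a ∷ x) (suc i) = symbolAt x i

symbolAt-≥ : ∀ {A : Set} (x : List A) i → length x ≤ i → symbolAt x i ≡ nothing
symbolAt-≥ [] i _ = refl
symbolAt-≥ (a ∷ x) (suc i) (s≤s le) = symbolAt-≥ x i le

symbolAt-< : ∀ {A : Set} (x : List A) i → i < length x → Σ A λ a → symbolAt x i ≡ just a
symbolAt-< (a ∷ x) zero _ = a , refl
symbolAt-< (a ∷ x) (suc i) (s≤s lt) = symbolAt-< x i lt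

module _ {k : ℕ} {B : Set} where
  inputCell : Sym k → Maybe (Sym k ⊎ B)
  inputCell a = just (inj₁ a)

  inputSymbol : Maybe (Sym k ⊎ B) → Maybe (Sym k)
  inputSymbol (just (inj₁ a)) = just a
  inputSymbol _ = nothing

  inputTape : Word k → Tape (Maybe (Sym k ⊎ B))
  inputTape x i = Maybe.map inj₁ (symbolAt x i)

  data NonInput : Maybe (Sym k ⊎ B) → Set where
    blank : NonInput nothing
    extra : ∀ b → NonInput (just (inj₂ b))

  -- What readOut returns when the machine halts with its head on cell p.
  Output : Tape (Maybe (Sym k ⊎ B)) → ℕ → Word k → Set
  Output h p [] = NonInput (h p)
  Output h p (a ∷ w) = h p ≡ just (inj₁ a) × Output h (suc p) w

  nonInput-inputSymbol : ∀ {c} → NonInput c → inputSymbol c ≡ nothing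
  nonInput-inputSymbol blank = refl
  nonInput-inputSymbol (extra _) = refl

  nonInput-input : ∀ {c a} → NonInput c → c ≡ just (inj₁ a) → ⊥
  nonInput-input blank ()
  nonInput-input (extra _) ()

  output-unique : ∀ {h p} w w' → Output h p w → Output h p w' → w ≡ w'
  output-unique [] [] _ _ = refl
  output-unique [] (a ∷ w') ni (e , _) = ⊥-elim (nonInput-input ni e)
  output-unique (a ∷ w) [] (e , _) ni = ⊥-elim (nonInput-input ni e)
  output-unique {h} {p} (a ∷ w) (b ∷ w') (e , o) (e' , o') with h p
  output-unique (a ∷ w) (.a ∷ w') (refl , o) (refl , o') | _ = cong (a ∷_) (output-unique w w' o o')

module _ {A : Set} where
  -- The left part of a configuration is stored nearest-cell-first, so its last element sits on cell 0.
  LeftPart : List (Maybe A) → Tape (Maybe A) → Set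
  LeftPart [] h = ⊤
  LeftPart (c ∷ l) h = h (length l) ≡ c × LeftPart l h

  RightPart : List (Maybe A) → Tape (Maybe A) → ℕ → Set
  RightPart [] h p = ∀ j → h (j + p) ≡ nothing
  RightPart (c ∷ r) h p = h p ≡ c × RightPart r h (suc p)

  leftPart-cong : ∀ l {h h'} → LeftPart l h → h ≗ h' → LeftPart l h'
  leftPart-cong [] _ _ = tt
  leftPart-cong (c ∷ l) (e , lp) h≗h' = trans (sym (h≗h' _)) e , leftPart-cong l lp h≗h'

  rightPart-cong : ∀ r {h h'} p → RightPart r h p → h ≗ h' → RightPart r h' p
  rightPart-cong [] p rp h≗h' j = trans (sym (h≗h' _)) (rp j)
  rightPart-cong (c ∷ r) p (e , rp) h≗h' = trans (sym (h≗h' _)) e , rightPart-cong r (suc p) rp h≗h'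

  leftPart-write : ∀ l {h} q c → LeftPart l h → length l ≤ q → LeftPart l (h [ q ]≔ c)
  leftPart-write [] q c _ _ = tt
  leftPart-write (c' ∷ l) {h} q c (e , lp) l<q =
    trans ([]≔-other h c (<⇒≢ l<q)) e , leftPart-write l q c lp (≤-trans (n≤1+n _) l<q)

  rightPart-write : ∀ r {h} q c p → RightPart r h p → q < p → RightPart r (h [ q ]≔ c) p
  rightPart-write [] {h} q c p rp q<p j = trans ([]≔-other h c (>⇒≢ (<-≤-trans q<p (m≤n+m p j)))) (rp j)
  rightPart-write (c' ∷ r) {h} q c p (e , rp) q<p =
    trans ([]≔-other h c (>⇒≢ q<p)) e , rightPart-write r q c (suc p) rp (≤-trans q<p (n≤1+n _))

module TapeSemantics {k : ℕ} (M : TM k) where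
  open TM M
  open Steps δ public

  State : Set
  State = Fin (suc nStates)

  Represents : Config M → Tape (Cell M) → Set
  Represents (config s l c r) h = LeftPart l h × h (length l) ≡ c × RightPart r h (suc (length l))

  headPos : Config M → ℕ
  headPos z = length (Config.left z)

  represents-cong : ∀ z {h h'} → Represents z h → h ≗ h' → Represents z h'
  represents-cong (config s l c r) (lp , e , rp) h≗h' =
    leftPart-cong l lp h≗h' , trans (sym (h≗h' _)) e , rightPart-cong r _ rp h≗h'

  initConfig-represents : ∀ x → Represents (initConfig M x) (inputTape x)
  initConfig-represents [] = tt , refl , λ _ → refl
  initConfig-represents (a ∷ x) = tt , refl , rest x 1 (λ i → cong input (+-comm i 1))
    where
    input : Tape (Cell M)
    input = inputTape (a ∷ x)
    rest : ∀ as p → (∀ i → input (i + p) ≡ inputTape as i) → RightPart (map (λ b → just (inj₁ b)) as) input p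
    rest [] p shifted j = shifted j
    rest (b ∷ as) p shifted = shifted 0 , rest as (suc p) (λ i → trans (cong input (+-suc i p)) (shifted (suc i)))

  initConfig-state : ∀ x → Config.state (initConfig M x) ≡ zero
  initConfig-state [] = refl
  initConfig-state (_ ∷ _) = refl

  initConfig-headPos : ∀ x → headPos (initConfig M x) ≡ 0
  initConfig-headPos [] = refl
  initConfig-headPos (_ ∷ _) = refl

  state-applyMove : ∀ m z → Config.state (applyMove M m z) ≡ Config.state z
  state-applyMove stay z = refl
  state-applyMove moveR (config q l c []) = refl
  state-applyMove moveR (config q l c (_ ∷ r)) = refl
  state-applyMove moveL (config q [] c r) = refl
  state-applyMove moveL (config q (_ ∷ l) c r) = refl

  headPos-applyMove : ∀ m s l c r → headPos (applyMove M m (config s l c r)) ≡ moveHead m (length l)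
  headPos-applyMove stay s l c r = refl
  headPos-applyMove moveR s l c [] = refl
  headPos-applyMove moveR s l c (_ ∷ r) = refl
  headPos-applyMove moveL s [] c r = refl
  headPos-applyMove moveL s (_ ∷ l) c r = refl

  represents-step : ∀ s l c r q c' m h → Represents (config s l c r) h →
    Represents (applyMove M m (config q l c' r)) (h [ length l ]≔ c')
  represents-step s l c r q c' stay h (lp , _ , rp) =
    leftPart-write l _ c' lp ≤-refl , []≔-same h (length l) c' , rightPart-write r _ c' _ rp ≤-refl
  represents-step s [] c r q c' moveL h (_ , _ , rp) =
    tt , []≔-same h 0 c' , rightPart-write r _ c' _ rp ≤-refl
  represents-step s (c₀ ∷ l) c r q c' moveL h ((e₀ , lp) , _ , rp) =
    leftPart-write l _ c' lp (n≤1+n _) , trans ([]≔-other h c' (<⇒≢ ≤-refl)) e₀ ,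
    []≔-same h (suc (length l)) c' , rightPart-write r _ c' _ rp ≤-refl
  represents-step s l c [] q c' moveR h (lp , _ , rp) =
    ([]≔-same h (length l) c' , leftPart-write l _ c' lp ≤-refl) ,
    trans ([]≔-other h c' (>⇒≢ ≤-refl)) (rp 0) ,
    λ j → trans ([]≔-other h c' (>⇒≢ (≤-trans (n≤1+n _) (m≤n+m _ j))))
                (trans (cong h (+-suc j (suc (length l)))) (rp (suc j)))
  represents-step s l c (c₁ ∷ r) q c' moveR h (lp , _ , (e₁ , rp)) =
    ([]≔-same h (length l) c' , leftPart-write l _ c' lp ≤-refl) ,
    trans ([]≔-other h c' (>⇒≢ ≤-refl)) e₁ , rightPart-write r _ c' _ rp (n≤1+n _)

  readOut-output : ∀ cs h p → RightPart cs h p → Output h p (readOut M cs)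
  readOut-output [] h p rp rewrite rp 0 = blank
  readOut-output (nothing ∷ cs) h p (e , _) rewrite e = blank
  readOut-output (just (inj₂ b) ∷ cs) h p (e , _) rewrite e = extra b
  readOut-output (just (inj₁ a) ∷ cs) h p (e , rp) = e , readOut-output cs h (suc p) rp

  record HaltsWithin (s : State) (h : Tape (Cell M)) (p : ℕ) (w : Word k) (n : ℕ) : Set where
    field
      {time finalPos} : ℕ
      {finalState} : State
      {finalTape} : Tape (Cell M)
      time≤ : time ≤ n
      runs : Runs s h p finalState finalTape finalPos time
      halts : δ finalState (finalTape finalPos) ≡ nothing
      output : Output finalTape finalPos w

  exec⇒haltsWithin : ∀ n z h w → Represents z h → exec M n z ≡ just w →
    HaltsWithin (Config.state z) h (headPos z) w n
  exec⇒haltsWithin n (config s l c r) h w rep@(_ , e , rp) ex with δ s c in δ≡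
  ... | nothing = record
    { time≤ = z≤n ; runs = done (λ _ → refl) ; halts = trans (cong (δ s) e) δ≡
    ; output = subst (Output h (length l)) (just-injective ex) (readOut-output (c ∷ r) h (length l) (e , rp)) }
  exec⇒haltsWithin (suc n) (config s l c r) h w rep@(_ , e , _) ex | just (q , c' , m) =
    record { time≤ = s≤s time≤ ; runs = more (trans (cong (δ s) e) δ≡) runs' ; halts = halts ; output = output }
    where
    z' = applyMove M m (config q l c' r)
    open HaltsWithin (exec⇒haltsWithin n z' (h [ length l ]≔ c') w (represents-step s l c r q c' m h rep) ex)
    runs' = subst₂ (λ s' p' → Runs s' (h [ length l ]≔ c') p' finalState finalTape finalPos time)
                   (state-applyMove m (config q l c' r)) (headPos-applyMove m q l c' r) runs

  exec-suc : ∀ {n s l c r q c' m} → δ s c ≡ just (q , c' , m) →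
    exec M (suc n) (config s l c r) ≡ exec M n (applyMove M m (config q l c' r))
  exec-suc δ≡ rewrite δ≡ = refl

  exec-init⇒haltsWithin : ∀ n x {w} → exec M n (initConfig M x) ≡ just w → HaltsWithin zero (inputTape x) 0 w n
  exec-init⇒haltsWithin n [] = exec⇒haltsWithin n _ _ _ (initConfig-represents [])
  exec-init⇒haltsWithin n (a ∷ x) = exec⇒haltsWithin n _ _ _ (initConfig-represents (a ∷ x))

  runs⇒exec : ∀ {s h p s' h' p' n} → Runs s h p s' h' p' n → ∀ z → Represents z h →
    Config.state z ≡ s → headPos z ≡ p →
    Σ (Config M) λ z' → (∀ F → exec M (n + F) z ≡ exec M F z') × Represents z' h' ×
      Config.state z' ≡ s' × headPos z' ≡ p'
  runs⇒exec (done h≗h') z rep refl refl = z , (λ _ → refl) , represents-cong z rep h≗h' , refl , refl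
  runs⇒exec {h = h} (more {s₁ = s₁} {c = c'} {m = m} st r) (config s l c rr) rep@(_ , e , _) refl refl
    with runs⇒exec r (applyMove M m (config s₁ l c' rr)) (represents-step s l c rr s₁ c' m h rep)
                     (state-applyMove m (config s₁ l c' rr)) (headPos-applyMove m s₁ l c' rr)
  ... | z' , ex , rest = z' , (λ F → trans (exec-suc (trans (cong (δ s) (sym e)) st)) (ex F)) , rest

  halted⇒exec : ∀ z h w → Represents z h → δ (Config.state z) (h (headPos z)) ≡ nothing →
    Output h (headPos z) w → ∀ F → exec M F z ≡ just w
  halted⇒exec (config s l c r) h w (_ , e , rp) halts out F rewrite sym e | halts =
    cong just (output-unique _ _ (readOut-output (h (length l) ∷ r) h (length l) (refl , rp)) out)

-- Polynomial bounds

PolyBounded : (ℕ → ℕ) → Set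
PolyBounded T = Σ ℕ λ c → ∀ n → T n ≤ c * n ^ c + c

data Polynomial : Set where
  con : ℕ → Polynomial
  var : Polynomial
  _⊕_ _⊗_ : Polynomial → Polynomial → Polynomial

infixl 6 _⊕_
infixl 7 _⊗_
infixr 8 _⊙_

⟦_⟧ : Polynomial → ℕ → ℕ
⟦ con a ⟧ n = a
⟦ var ⟧ n = n
⟦ p ⊕ q ⟧ n = ⟦ p ⟧ n + ⟦ q ⟧ n
⟦ p ⊗ q ⟧ n = ⟦ p ⟧ n * ⟦ q ⟧ n

_⊙_ : Polynomial → ℕ → Polynomial
p ⊙ zero = con 1
p ⊙ suc c = p ⊗ p ⊙ c

⟦⊙⟧ : ∀ p c n → ⟦ p ⊙ c ⟧ n ≡ ⟦ p ⟧ n ^ c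
⟦⊙⟧ p zero n = refl
⟦⊙⟧ p (suc c) n = cong (⟦ p ⟧ n *_) (⟦⊙⟧ p c n)

n^a≤n^c+1 : ∀ n {a c} → a ≤ c → n ^ a ≤ n ^ c + 1
n^a≤n^c+1 zero {zero} _ = m≤n+m 1 _
n^a≤n^c+1 zero {suc a} _ = z≤n
n^a≤n^c+1 (suc n) a≤c = ≤-trans (^-monoʳ-≤ (suc n) a≤c) (m≤m+n _ 1)

raise-exponent : ∀ n {a c} → a ≤ c → a * n ^ a + a ≤ a * n ^ c + 2 * a
raise-exponent n {a} {c} a≤c = begin
  a * n ^ a + a        ≤⟨ +-monoˡ-≤ a (*-monoʳ-≤ a (n^a≤n^c+1 n a≤c)) ⟩
  a * (n ^ c + 1) + a  ≡⟨ expand a (n ^ c) ⟩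
  a * n ^ c + 2 * a    ∎
  where
  open ≤-Reasoning
  expand : ∀ a x → a * (x + 1) + a ≡ a * x + 2 * a
  expand = solve-∀

con-bounded : ∀ a → PolyBounded (λ _ → a)
con-bounded a = a , λ n → m≤n+m a _

var-bounded : PolyBounded (λ n → n)
var-bounded = 1 , λ n → ≤-trans (≤-reflexive (sym (trans (*-identityˡ (n ^ 1)) (*-identityʳ n)))) (m≤m+n _ 1)

+-bounded : ∀ {T U} → PolyBounded T → PolyBounded U → PolyBounded (λ n → T n + U n)
+-bounded {T} {U} (a , Ta) (b , Ub) = c , λ n → begin
  T n + U n                                   ≤⟨ +-mono-≤ (≤-trans (Ta n) (raise-exponent n a≤c))
                                                          (≤-trans (Ub n) (raise-exponent n b≤c)) ⟩
  a * n ^ c + 2 * a + (b * n ^ c + 2 * b)     ≡⟨ regroup a b (n ^ c) ⟩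
  (a + b) * n ^ c + c                          ≤⟨ +-monoˡ-≤ c (*-monoˡ-≤ (n ^ c) (m≤m+n (a + b) (a + b))) ⟩
  c * n ^ c + c                                ∎
  where
  open ≤-Reasoning
  c = (a + b) + (a + b)
  regroup : ∀ a b x → a * x + 2 * a + (b * x + 2 * b) ≡ (a + b) * x + ((a + b) + (a + b))
  regroup = solve-∀
  a≤c : a ≤ c
  a≤c = ≤-trans (m≤m+n a b) (m≤m+n (a + b) (a + b))
  b≤c : b ≤ c
  b≤c = ≤-trans (m≤n+m b a) (m≤m+n (a + b) (a + b))

*-bounded : ∀ {T U} → PolyBounded T → PolyBounded U → PolyBounded (λ n → T n * U n)
*-bounded {T} {U} (a , Ta) (b , Ub) = c , λ n → begin
  T n * U n                                               ≤⟨ *-mono-≤ (Ta n) (Ub n) ⟩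
  (a * n ^ a + a) * (b * n ^ b + b)                       ≡⟨ expand a b (n ^ a) (n ^ b) ⟩
  m * (n ^ a * n ^ b) + m * n ^ a + m * n ^ b + m         ≡⟨ cong (λ y → m * y + m * n ^ a + m * n ^ b + m)
                                                                  (sym (^-distribˡ-+-* n a b)) ⟩
  m * n ^ (a + b) + m * n ^ a + m * n ^ b + m
    ≤⟨ +-monoˡ-≤ m (+-mono-≤ (+-mono-≤ (raise n ab≤c) (raise n a≤c)) (raise n b≤c)) ⟩
  m * (n ^ c + 1) + m * (n ^ c + 1) + m * (n ^ c + 1) + m ≡⟨ collect m (n ^ c) ⟩
  3 * m * n ^ c + 4 * m                                   ≤⟨ +-mono-≤ (*-monoˡ-≤ (n ^ c) 3m≤c) 4m≤c ⟩
  c * n ^ c + c                                           ∎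
  where
  open ≤-Reasoning
  m = a * b
  c = 4 * m + a + b
  expand : ∀ a b x y → (a * x + a) * (b * y + b) ≡ a * b * (x * y) + a * b * x + a * b * y + a * b
  expand = solve-∀
  collect : ∀ m x → m * (x + 1) + m * (x + 1) + m * (x + 1) + m ≡ 3 * m * x + 4 * m
  collect = solve-∀
  4m≤c : 4 * m ≤ c
  4m≤c = ≤-trans (m≤m+n (4 * m) a) (m≤m+n (4 * m + a) b)
  3m≤c : 3 * m ≤ c
  3m≤c = ≤-trans (*-monoˡ-≤ m (n≤1+n 3)) 4m≤c
  ab≤c : a + b ≤ c
  ab≤c = subst (_≤ c) (+-assoc 0 a b) (+-monoˡ-≤ b (+-monoˡ-≤ a (z≤n {4 * m})))
  a≤c : a ≤ c
  a≤c = ≤-trans (m≤m+n a b) ab≤c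
  b≤c : b ≤ c
  b≤c = ≤-trans (m≤n+m b a) ab≤c
  raise : ∀ n {e} → e ≤ c → m * n ^ e ≤ m * (n ^ c + 1)
  raise n e≤c = *-monoʳ-≤ m (n^a≤n^c+1 n e≤c)

polynomial-bounded : ∀ p → PolyBounded ⟦ p ⟧
polynomial-bounded (con a) = con-bounded a
polynomial-bounded var = var-bounded
polynomial-bounded (p ⊕ q) = +-bounded (polynomial-bounded p) (polynomial-bounded q)
polynomial-bounded (p ⊗ q) = *-bounded (polynomial-bounded p) (polynomial-bounded q)

timeBound : ℕ → Polynomial
timeBound c = con c ⊗ var ⊙ c ⊕ con c

⟦timeBound⟧ : ∀ c n → ⟦ timeBound c ⟧ n ≡ c * n ^ c + c
⟦timeBound⟧ c n = cong (λ y → c * y + c) (⟦⊙⟧ var c n)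

copyTime : ℕ → ℕ
copyTime E = 16 * (suc E * suc E)

copyTime-mono : ∀ {E E'} → E ≤ E' → copyTime E ≤ copyTime E'
copyTime-mono E≤E' = *-monoʳ-≤ 16 (*-mono-≤ (s≤s E≤E') (s≤s E≤E'))

-- For machines for f and g running in times A and B on inputs of length n: encoding the input takes
-- 2n + 1 steps, the two simulations A + B + (n + 1 + A + 3), and copying the outputs copyTime E,
-- where E ≤ n + 1 + A + B + 2 bounds the region used by the simulations.
pairingBound : Polynomial → Polynomial → Polynomial
pairingBound a b = con 2 ⊗ var ⊕ con 1 ⊕ (a ⊕ b ⊕ (con 1 ⊕ var ⊕ a ⊕ con 3)) ⊕ con 16 ⊗ (s ⊗ s)
  where s = con 1 ⊕ (con 1 ⊕ var ⊕ a ⊕ b ⊕ con 2)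

-- The pairing machine

data Track : Set where
  trackF trackG : Track

Track-finite : Finite Track
Track-finite = retract-finite toBool fromBool fromBool-toBool Bool-finite
  where
  toBool : Track → Bool
  toBool trackF = true
  toBool trackG = false
  fromBool : Bool → Track
  fromBool true = trackF
  fromBool false = trackG
  fromBool-toBool : ∀ t → fromBool (toBool t) ≡ t
  fromBool-toBool trackF = refl
  fromBool-toBool trackG = refl

-- The work symbols of H are the codes of columns of Tracks; input symbols occur only in the input
-- and in the output being written behind the used region.
module PairingMachine {k : ℕ} (Mf Mg : TM k) where
  record Tracks : Set where
    constructor tracks
    field
      cellF : Cell Mf
      cellG : Cell Mg
      leftEnd headF headG doneF doneG : Bool
  open Tracks public

  Tracks-finite : Finite Tracks
  Tracks-finite = retract-finite to from (λ _ → refl)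
    (×-finite (cell-finite _) (×-finite (cell-finite _)
      (×-finite Bool-finite (×-finite Bool-finite (×-finite Bool-finite (×-finite Bool-finite Bool-finite))))))
    where
    cell-finite : ∀ e → Finite (Maybe (Sym k ⊎ Fin e))
    cell-finite e = Maybe-finite (⊎-finite (Fin-finite _) (Fin-finite e))
    to : Tracks → Cell Mf × Cell Mg × Bool × Bool × Bool × Bool × Bool
    to (tracks a b c d e f g) = a , b , c , d , e , f , g
    from : Cell Mf × Cell Mg × Bool × Bool × Bool × Bool × Bool → Tracks
    from (a , b , c , d , e , f , g) = tracks a b c d e f g

  -- Abstract, so that type checking never normalises these finite encodings.
  abstract
    nTracks : ℕ
    nTracks = size Tracks-finite

    packIndex : Tracks → Fin nTracks
    packIndex = toFin Tracks-finite

    unpackIndex : Fin nTracks → Tracks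
    unpackIndex = fromFin Tracks-finite

    unpackIndex-packIndex : ∀ r → unpackIndex (packIndex r) ≡ r
    unpackIndex-packIndex = fromFin-toFin Tracks-finite

  HCell : Set
  HCell = Maybe (Sym k ⊎ Fin nTracks)

  pack : Tracks → HCell
  pack r = just (inj₂ (packIndex r))

  blankTracks : Tracks
  blankTracks = tracks nothing nothing false false false false false

  unpack : HCell → Tracks
  unpack (just (inj₂ i)) = unpackIndex i
  unpack _ = blankTracks

  unpack-pack : ∀ r → unpack (pack r) ≡ r
  unpack-pack = unpackIndex-packIndex

  headOn doneOn : Track → Tracks → Bool
  headOn trackF = headF
  headOn trackG = headG
  doneOn trackF = doneF
  doneOn trackG = doneG

  symbolOn : Track → Tracks → Maybe (Sym k)
  symbolOn trackF r = inputSymbol (cellF r)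
  symbolOn trackG r = inputSymbol (cellG r)

  markDone : Track → Tracks → Tracks
  markDone trackF r = record r { doneF = true }
  markDone trackG r = record r { doneG = true }

  -- In ⟨ f x , g x ⟩ every symbol of f x is doubled.
  copiesOf : Track → Sym k → Word k
  copiesOf trackF a = a ∷ a ∷ []
  copiesOf trackG a = a ∷ []

  data St : Set where
    copyInput rewindF rewindG writeSep writeSep₂ findOutput : St
    simF : Fin (suc (TM.nStates Mf)) → St
    simG : Fin (suc (TM.nStates Mg)) → St
    rewind findHead skipCopied : Track → St
    carry : Track → Sym k → St
    carryTwin : Sym k → St

  afterCopy : Track → St
  afterCopy trackF = writeSep
  afterCopy trackG = findOutput

  St-finite : Finite St
  St-finite = retract-finite to from from-to
    (⊎-finite ⊤-finite (⊎-finite ⊤-finite (⊎-finite ⊤-finite (⊎-finite ⊤-finite (⊎-finite ⊤-finite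
      (⊎-finite ⊤-finite (⊎-finite (Fin-finite _) (⊎-finite (Fin-finite _) (⊎-finite Track-finite
        (⊎-finite Track-finite (⊎-finite Track-finite
          (⊎-finite (×-finite Track-finite (Fin-finite _)) (Fin-finite _)))))))))))))
    where
    Code = ⊤ ⊎ ⊤ ⊎ ⊤ ⊎ ⊤ ⊎ ⊤ ⊎ ⊤ ⊎ Fin (suc (TM.nStates Mf)) ⊎ Fin (suc (TM.nStates Mg)) ⊎
           Track ⊎ Track ⊎ Track ⊎ (Track × Sym k) ⊎ Sym k
    to : St → Code
    to copyInput = inj₁ tt
    to rewindF = inj₂ (inj₁ tt)
    to rewindG = inj₂ (inj₂ (inj₁ tt))
    to writeSep = inj₂ (inj₂ (inj₂ (inj₁ tt)))
    to writeSep₂ = inj₂ (inj₂ (inj₂ (inj₂ (inj₁ tt))))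
    to findOutput = inj₂ (inj₂ (inj₂ (inj₂ (inj₂ (inj₁ tt)))))
    to (simF q) = inj₂ (inj₂ (inj₂ (inj₂ (inj₂ (inj₂ (inj₁ q))))))
    to (simG q) = inj₂ (inj₂ (inj₂ (inj₂ (inj₂ (inj₂ (inj₂ (inj₁ q)))))))
    to (rewind t) = inj₂ (inj₂ (inj₂ (inj₂ (inj₂ (inj₂ (inj₂ (inj₂ (inj₁ t))))))))
    to (findHead t) = inj₂ (inj₂ (inj₂ (inj₂ (inj₂ (inj₂ (inj₂ (inj₂ (inj₂ (inj₁ t)))))))))
    to (skipCopied t) = inj₂ (inj₂ (inj₂ (inj₂ (inj₂ (inj₂ (inj₂ (inj₂ (inj₂ (inj₂ (inj₁ t))))))))))
    to (carry t a) = inj₂ (inj₂ (inj₂ (inj₂ (inj₂ (inj₂ (inj₂ (inj₂ (inj₂ (inj₂ (inj₂ (inj₁ (t , a))))))))))))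
    to (carryTwin a) = inj₂ (inj₂ (inj₂ (inj₂ (inj₂ (inj₂ (inj₂ (inj₂ (inj₂ (inj₂ (inj₂ (inj₂ a)))))))))))
    from : Code → St
    from (inj₁ _) = copyInput
    from (inj₂ (inj₁ _)) = rewindF
    from (inj₂ (inj₂ (inj₁ _))) = rewindG
    from (inj₂ (inj₂ (inj₂ (inj₁ _)))) = writeSep
    from (inj₂ (inj₂ (inj₂ (inj₂ (inj₁ _))))) = writeSep₂
    from (inj₂ (inj₂ (inj₂ (inj₂ (inj₂ (inj₁ _)))))) = findOutput
    from (inj₂ (inj₂ (inj₂ (inj₂ (inj₂ (inj₂ (inj₁ q))))))) = simF q
    from (inj₂ (inj₂ (inj₂ (inj₂ (inj₂ (inj₂ (inj₂ (inj₁ q)))))))) = simG q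
    from (inj₂ (inj₂ (inj₂ (inj₂ (inj₂ (inj₂ (inj₂ (inj₂ (inj₁ t))))))))) = rewind t
    from (inj₂ (inj₂ (inj₂ (inj₂ (inj₂ (inj₂ (inj₂ (inj₂ (inj₂ (inj₁ t)))))))))) = findHead t
    from (inj₂ (inj₂ (inj₂ (inj₂ (inj₂ (inj₂ (inj₂ (inj₂ (inj₂ (inj₂ (inj₁ t))))))))))) = skipCopied t
    from (inj₂ (inj₂ (inj₂ (inj₂ (inj₂ (inj₂ (inj₂ (inj₂ (inj₂ (inj₂ (inj₂ (inj₁ (t , a))))))))))))) = carry t a
    from (inj₂ (inj₂ (inj₂ (inj₂ (inj₂ (inj₂ (inj₂ (inj₂ (inj₂ (inj₂ (inj₂ (inj₂ a)))))))))))) = carryTwin a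
    from-to : ∀ s → from (to s) ≡ s
    from-to copyInput = refl
    from-to rewindF = refl
    from-to rewindG = refl
    from-to writeSep = refl
    from-to writeSep₂ = refl
    from-to findOutput = refl
    from-to (simF q) = refl
    from-to (simG q) = refl
    from-to (rewind t) = refl
    from-to (findHead t) = refl
    from-to (skipCopied t) = refl
    from-to (carry t a) = refl
    from-to (carryTwin a) = refl

  Action : Set
  Action = Maybe (Maybe St × HCell × Move)

  goto : St → HCell → Move → Action
  goto s c m = just (just s , c , m)

  δ-start : HCell → Action
  δ-start (just (inj₁ a)) = goto copyInput (pack (tracks (inputCell a) (inputCell a) true false false false false)) moveR
  δ-start _ = goto (simF zero) (pack (tracks nothing nothing true false false false false)) stay

  δ-copyInput : HCell → Action
  δ-copyInput (just (inj₁ a)) = goto copyInput (pack (tracks (inputCell a) (inputCell a) false false false false false)) moveR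
  δ-copyInput c = goto rewindF c moveL

  δ-rewind : St → St → HCell → Action
  δ-rewind s s' c with leftEnd (unpack c)
  ... | true = goto s' c stay
  ... | false = goto s c moveL

  δ-simF : Fin (suc (TM.nStates Mf)) → Tracks → Action
  δ-simF q r with TM.δ Mf q (cellF r)
  ... | just (q' , c , m) = goto (simF q') (pack (record r { cellF = c })) m
  ... | nothing = goto rewindG (pack (record r { headF = true })) stay

  δ-simG : Fin (suc (TM.nStates Mg)) → Tracks → Action
  δ-simG q r with TM.δ Mg q (cellG r)
  ... | just (q' , c , m) = goto (simG q') (pack (record r { cellG = c })) m
  ... | nothing = goto (rewind trackF) (pack (record r { headG = true })) stay

  δ-findHead : Track → HCell → Action
  δ-findHead t c with headOn t (unpack c)
  ... | true = goto (skipCopied t) c stay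
  ... | false = goto (findHead t) c moveR

  δ-skipCopied : Track → HCell → Tracks → Action
  δ-skipCopied t c r with doneOn t r | symbolOn t r
  ... | true | _ = goto (skipCopied t) c moveR
  ... | false | just a = goto (carry t a) (pack (markDone t r)) moveR
  ... | false | nothing = goto (afterCopy t) c stay

  δ-carry : Track → Sym k → HCell → Action
  δ-carry trackF a nothing = goto (carryTwin a) (inputCell a) moveR
  δ-carry trackG a nothing = goto (rewind trackG) (inputCell a) moveL
  δ-carry t a c = goto (carry t a) c moveR

  δ-writeSep : HCell → Action
  δ-writeSep nothing = goto writeSep₂ (inputCell zero) moveR
  δ-writeSep c = goto writeSep c moveR

  δ-findOutput : HCell → Action
  δ-findOutput (just (inj₁ a)) = nothing
  δ-findOutput c = goto findOutput c moveR

  step : Maybe St → HCell → Action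
  step nothing c = δ-start c
  step (just copyInput) c = δ-copyInput c
  step (just rewindF) c = δ-rewind rewindF (simF zero) c
  step (just (simF q)) c = δ-simF q (unpack c)
  step (just rewindG) c = δ-rewind rewindG (simG zero) c
  step (just (simG q)) c = δ-simG q (unpack c)
  step (just (rewind t)) c = δ-rewind (rewind t) (findHead t) c
  step (just (findHead t)) c = δ-findHead t c
  step (just (skipCopied t)) c = δ-skipCopied t c (unpack c)
  step (just (carry t a)) c = δ-carry t a c
  step (just (carryTwin a)) c = goto (rewind trackF) (inputCell a) moveL
  step (just writeSep) c = δ-writeSep c
  step (just writeSep₂) c = goto (rewind trackG) (inputCell (suc zero)) moveL
  step (just findOutput) c = δ-findOutput c

  abstract
    nStates : ℕ
    nStates = size St-finite

    stateIndex : Maybe St → Fin (suc nStates)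
    stateIndex = toFin (Maybe-finite St-finite)

    indexState : Fin (suc nStates) → Maybe St
    indexState = fromFin (Maybe-finite St-finite)

    indexState-stateIndex : ∀ s → indexState (stateIndex s) ≡ s
    indexState-stateIndex = fromFin-toFin (Maybe-finite St-finite)

    stateIndex-start : stateIndex nothing ≡ zero
    stateIndex-start = refl

  H : TM k
  H = record
    { nStates = nStates
    ; nExtra = nTracks
    ; δ = λ i c → Maybe.map (λ { (s , c' , m) → stateIndex s , c' , m }) (step (indexState i) c) }

module PairingRuns {k : ℕ} (Mf Mg : TM k) where
  open PairingMachine Mf Mg
  open Steps step public
  module HS = TapeSemantics H

  lift-runs : ∀ {s h p s' h' p' n} → Runs s h p s' h' p' n →
    HS.Runs (stateIndex s) h p (stateIndex s') h' p' n
  lift-runs (done h≗h') = HS.done h≗h'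
  lift-runs {s} {h} {p} (more {s₁ = s₁} {c = c} {m = m} st r) = HS.more δ≡ (lift-runs r)
    where
    δ≡ : TM.δ H (stateIndex s) (h p) ≡ just (stateIndex s₁ , c , m)
    δ≡ rewrite indexState-stateIndex s | st = refl

  LeftEndAt0 : (ℕ → Tracks) → Set
  LeftEndAt0 D = leftEnd (D 0) ≡ true × (∀ i → leftEnd (D (suc i)) ≡ false)

  rewind-runs : ∀ {s s'} → (∀ c → step (just s) c ≡ δ-rewind s s' c) → ∀ h p → LeftEndAt0 (unpack ∘ h) →
    Runs (just s) h p (just s') h 0 (p + 1)
  rewind-runs {s} {s'} rewinds h p (at0 , notAt) =
    sweepLeft (just s) p 0 h (λ j _ → trans (rewinds _) (move (notAt j))) ⨾ stay-runs (trans (rewinds _) (arrive at0))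
    where
    move : ∀ {c} → leftEnd (unpack c) ≡ false → δ-rewind s s' c ≡ goto s c moveL
    move e rewrite e = refl
    arrive : ∀ {c} → leftEnd (unpack c) ≡ true → δ-rewind s s' c ≡ goto s' c stay
    arrive e rewrite e = refl

  encodedInput : Word k → ℕ → Tracks
  encodedInput x i = tracks (inputTape x i) (inputTape x i) (i ≡ᵇ 0) false false false false

  -- Even the empty input gets one encoded cell, to carry the left-end marker.
  width : Word k → ℕ
  width [] = 1
  width (_ ∷ x) = suc (length x)

  encodedTape : Word k → Tape HCell
  encodedTape x = glue (width x) (pack ∘ encodedInput x) (λ _ → nothing)

  unpack-encodedTape : ∀ x i → unpack (encodedTape x i) ≡ encodedInput x i
  unpack-encodedTape x i with <-≤-connex i (width x)
  ... | inj₁ i<w = trans (cong unpack (glue-< (width x) _ _ i<w)) (unpack-pack _)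
  ... | inj₂ w≤i = trans (cong unpack (glue-≥ (width x) _ _ w≤i)) (sym (beyond x i w≤i))
    where
    beyond : ∀ x i → width x ≤ i → encodedInput x i ≡ blankTracks
    beyond [] (suc i) _ = refl
    beyond (a ∷ x) (suc i) (s≤s x≤i) rewrite symbolAt-≥ x i x≤i = refl

  encodedTape-leftEnd : ∀ x → LeftEndAt0 (unpack ∘ encodedTape x)
  encodedTape-leftEnd x = cong leftEnd (unpack-encodedTape x 0) , λ i → cong leftEnd (unpack-encodedTape x (suc i))

  module EncodeInput (a : Sym k) (x : Word k) where
    partial : ℕ → Tape HCell
    partial j = glue j (pack ∘ encodedInput (a ∷ x)) (inputTape (a ∷ x))

    copy-runs : ∀ d i → i + d ≡ length x →
      Runs (just copyInput) (partial (suc i)) (suc i) (just rewindF) (partial (suc (length x))) (length x) (suc d)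
    copy-runs zero i i+0≡ with trans (sym (+-identityʳ i)) i+0≡
    ... | refl = more st (done ([]≔-self _ _))
      where
      st : step (just copyInput) (partial (suc i) (suc i)) ≡ goto rewindF (partial (suc i) (suc i)) moveL
      st rewrite glue-≥ (suc i) (pack ∘ encodedInput (a ∷ x)) (inputTape (a ∷ x)) ≤-refl
               | symbolAt-≥ x i ≤-refl = refl
    copy-runs (suc d) i i+d≡
      with symbolAt-< x i (≤-trans (s≤s (m≤m+n i d)) (≤-reflexive (trans (sym (+-suc i d)) i+d≡)))
    ... | b , symbolAt≡ = more st (runs-cong (copy-runs d (suc i) (trans (sym (+-suc i d)) i+d≡)) (glue-suc (suc i) _ _))
      where
      st : step (just copyInput) (partial (suc i) (suc i)) ≡ goto copyInput (pack (encodedInput (a ∷ x) (suc i))) moveR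
      st rewrite glue-≥ (suc i) (pack ∘ encodedInput (a ∷ x)) (inputTape (a ∷ x)) ≤-refl | symbolAt≡ = refl

    partial≗encodedTape : partial (suc (length x)) ≗ encodedTape (a ∷ x)
    partial≗encodedTape i with <-≤-connex i (suc (length x))
    ... | inj₁ i<n = trans (glue-< _ _ _ i<n) (sym (glue-< _ _ _ i<n))
    ... | inj₂ n≤i = trans (glue-≥ _ _ _ n≤i) (trans (cong (Maybe.map inj₁) (symbolAt-≥ (a ∷ x) i n≤i))
                                                      (sym (glue-≥ _ _ _ n≤i)))

  encode-input : ∀ x → Runs nothing (inputTape x) 0 (just (simF zero)) (encodedTape x) 0 (2 * length x + 1)
  encode-input [] = runs-congʳ (step-runs refl) written
    where
    written : inputTape [] [ 0 ]≔ pack (encodedInput [] 0) ≗ encodedTape []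
    written zero = trans ([]≔-same (inputTape []) 0 _)
                         (sym (glue-< 1 (pack ∘ encodedInput []) (λ _ → nothing) (s≤s z≤n)))
    written (suc i) = trans ([]≔-other (inputTape []) {0} (pack (encodedInput [] 0)) {suc i} (λ ()))
                            (sym (glue-≥ 1 (pack ∘ encodedInput []) (λ _ → nothing) {suc i} (s≤s z≤n)))
  encode-input (a ∷ x) = subst (Runs nothing (inputTape (a ∷ x)) 0 (just (simF zero)) (encodedTape (a ∷ x)) 0)
                               (count (length x))
    (runs-congʳ (step-runs refl) started ⨾
     runs-congʳ (copy-runs (length x) 0 refl) partial≗encodedTape ⨾
     rewind-runs (λ _ → refl) (encodedTape (a ∷ x)) (length x) (encodedTape-leftEnd (a ∷ x)))
    where
    open EncodeInput a x
    started : inputTape (a ∷ x) [ 0 ]≔ pack (encodedInput (a ∷ x) 0) ≗ partial 1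
    started i = sym (trans (glue-suc 0 (pack ∘ encodedInput (a ∷ x)) (inputTape (a ∷ x)) i)
                           ([]≔-cong 0 _ (λ j → glue-≥ 0 (pack ∘ encodedInput (a ∷ x)) (inputTape (a ∷ x)) {j} z≤n) i))
    count : ∀ n → 1 + (suc n + (n + 1)) ≡ 2 * suc n + 1
    count = solve-∀

  IsPacked : HCell → Set
  IsPacked c = Σ (Fin nTracks) λ j → c ≡ just (inj₂ j)

  PackedBelow : Tape HCell → ℕ → Set
  PackedBelow h E = ∀ i → i < E → IsPacked (h i)

  UsedRegion : Tape HCell → ℕ → Set
  UsedRegion h E = PackedBelow h E × (∀ i → E ≤ i → h i ≡ nothing)

  encodedTape-used : ∀ x → UsedRegion (encodedTape x) (width x)
  encodedTape-used x = (λ i i<w → packIndex (encodedInput x i) , glue-< (width x) _ _ i<w) ,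
                       (λ i w≤i → glue-≥ (width x) _ _ w≤i)

  write-packed : ∀ h E q r → PackedBelow h E → PackedBelow (h [ q ]≔ pack r) E
  write-packed h E q r packed i i<E with i ℕ.≟ q
  ... | yes _ = packIndex r , refl
  ... | no _ = packed i i<E

  write-packed-extend : ∀ h p r → PackedBelow h p → PackedBelow (h [ p ]≔ pack r) (suc p)
  write-packed-extend h p r packed i i≤p with i ℕ.≟ p
  ... | yes _ = packIndex r , refl
  ... | no i≢p = packed i (≤∧≢⇒< (≤-pred i≤p) i≢p)

  usedRegion-write : ∀ h E p r → UsedRegion h E → p ≤ E →
    Σ ℕ λ E' → UsedRegion (h [ p ]≔ pack r) E' × p < E' × E' ≤ suc E × E ≤ E'
  usedRegion-write h E p r (packed , beyond) p≤E with m≤n⇒m<n∨m≡n p≤E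
  ... | inj₁ p<E = E , (write-packed h E p r packed , blank-beyond) , p<E , n≤1+n E , ≤-refl
    where
    blank-beyond : ∀ i → E ≤ i → (h [ p ]≔ pack r) i ≡ nothing
    blank-beyond i E≤i = trans ([]≔-other h _ (>⇒≢ (<-≤-trans p<E E≤i))) (beyond i E≤i)
  ... | inj₂ refl = suc p , (write-packed-extend h p r packed , blank-beyond) , ≤-refl , ≤-refl , n≤1+n p
    where
    blank-beyond : ∀ i → suc p ≤ i → (h [ p ]≔ pack r) i ≡ nothing
    blank-beyond i p<i = trans ([]≔-other h _ (>⇒≢ p<i)) (beyond i (<⇒≤ p<i))

  module Simulation (M : TM k) (σ : Fin (suc (TM.nStates M)) → St) (halted : St)
    (get : Tracks → Cell M) (set : Cell M → Tracks → Tracks) (markHead : Tracks → Tracks)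
    (get-set : ∀ c r → get (set c r) ≡ c) (set-set : ∀ c c' r → set c (set c' r) ≡ set c r)
    (δ-sim : ∀ q c {q' c' m} → TM.δ M q (get (unpack c)) ≡ just (q' , c' , m) →
             step (just (σ q)) c ≡ goto (σ q') (pack (set c' (unpack c))) m)
    (δ-halt : ∀ q c → TM.δ M q (get (unpack c)) ≡ nothing →
              step (just (σ q)) c ≡ goto halted (pack (markHead (unpack c))) stay) where
    module SM = TapeSemantics M

    simulate : ∀ {q hM p q' hM' p' t} → SM.Runs q hM p q' hM' p' t → ∀ (h : Tape HCell) (R : ℕ → Tracks) E →
      (∀ i → unpack (h i) ≡ set (hM i) (R i)) → UsedRegion h E → p ≤ E →
      Σ (Tape HCell) λ h' → Σ ℕ λ E' → Runs (just (σ q)) h p (just (σ q')) h' p' t ×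
        (∀ i → unpack (h' i) ≡ set (hM' i) (R i)) × UsedRegion h' E' × p' ≤ E' × E' ≤ E + t × E ≤ E'
    simulate (SM.done hM≗) h R E tracks≡ used p≤E =
      h , E , done (λ _ → refl) , (λ i → trans (tracks≡ i) (cong (λ c → set c (R i)) (hM≗ i))) , used , p≤E ,
      m≤m+n E 0 , ≤-refl
    simulate {q} {hM} {p} (SM.more {c = c} {m = m} δ≡ r) h R E tracks≡ used p≤E
      with usedRegion-write h E p (set c (unpack (h p))) used p≤E
    ... | E₁ , used₁ , p<E₁ , E₁≤ , E≤E₁
      with simulate r (h [ p ]≔ pack (set c (unpack (h p)))) R E₁ tracks₁ used₁ (≤-trans (moveHead≤1+ m p) p<E₁)
      where
      tracks₁ : ∀ i → unpack ((h [ p ]≔ pack (set c (unpack (h p)))) i) ≡ set ((hM [ p ]≔ c) i) (R i)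
      tracks₁ i with i ℕ.≟ p
      ... | yes refl = trans (unpack-pack _) (trans (cong (set c) (tracks≡ i)) (set-set c (hM i) (R i)))
      ... | no _ = tracks≡ i
    ... | h' , E' , runs , tracks' , used' , p'≤E' , E'≤ , E₁≤E' =
      h' , E' , more st runs , tracks' , used' , p'≤E' ,
      ≤-trans E'≤ (≤-trans (+-monoˡ-≤ _ E₁≤) (≤-reflexive (sym (+-suc E _)))) , ≤-trans E≤E₁ E₁≤E'
      where
      st = δ-sim q (h p) (trans (cong (TM.δ M q) (trans (cong get (tracks≡ p)) (get-set (hM p) (R p)))) δ≡)

    simulate-to-halt : ∀ {q hM p qH hH pH t} → SM.Runs q hM p qH hH pH t → TM.δ M qH (hH pH) ≡ nothing →
      ∀ (h : Tape HCell) (R : ℕ → Tracks) E → (∀ i → unpack (h i) ≡ set (hM i) (R i)) → UsedRegion h E → p ≤ E →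
      Σ (Tape HCell) λ h' → Σ ℕ λ E' → Runs (just (σ q)) h p (just halted) h' pH (t + 1) ×
        (∀ i → unpack (h' i) ≡ ((λ i → set (hH i) (R i)) [ pH ]≔ markHead (set (hH pH) (R pH))) i) ×
        UsedRegion h' E' × pH < E' × E' ≤ suc (E + t) × E ≤ E'
    simulate-to-halt {qH = qH} {hH} {pH} r halts h R E tracks≡ used p≤E with simulate r h R E tracks≡ used p≤E
    ... | h₁ , E₁ , runs , tracks₁ , used₁ , pH≤E₁ , E₁≤ , E≤E₁
      with usedRegion-write h₁ E₁ pH (markHead (unpack (h₁ pH))) used₁ pH≤E₁
    ... | E' , used' , pH<E' , E'≤ , E₁≤E' =
      h₁ [ pH ]≔ pack (markHead (unpack (h₁ pH))) , E' , runs ⨾ step-runs st , tracks' , used' , pH<E' ,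
      ≤-trans E'≤ (s≤s E₁≤) , ≤-trans E≤E₁ E₁≤E'
      where
      st = δ-halt qH (h₁ pH) (trans (cong (TM.δ M qH) (trans (cong get (tracks₁ pH)) (get-set (hH pH) (R pH)))) halts)
      tracks' : ∀ i → unpack ((h₁ [ pH ]≔ pack (markHead (unpack (h₁ pH)))) i) ≡
                      ((λ i → set (hH i) (R i)) [ pH ]≔ markHead (set (hH pH) (R pH))) i
      tracks' i with i ℕ.≟ pH
      ... | yes refl = trans (unpack-pack _) (cong markHead (tracks₁ i))
      ... | no _ = tracks₁ i

  δ-simF-step : ∀ q c {q' c' m} → TM.δ Mf q (cellF (unpack c)) ≡ just (q' , c' , m) →
    step (just (simF q)) c ≡ goto (simF q') (pack (record (unpack c) { cellF = c' })) m
  δ-simF-step q c δ≡ rewrite δ≡ = refl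

  δ-simF-halt : ∀ q c → TM.δ Mf q (cellF (unpack c)) ≡ nothing →
    step (just (simF q)) c ≡ goto rewindG (pack (record (unpack c) { headF = true })) stay
  δ-simF-halt q c δ≡ rewrite δ≡ = refl

  δ-simG-step : ∀ q c {q' c' m} → TM.δ Mg q (cellG (unpack c)) ≡ just (q' , c' , m) →
    step (just (simG q)) c ≡ goto (simG q') (pack (record (unpack c) { cellG = c' })) m
  δ-simG-step q c δ≡ rewrite δ≡ = refl

  δ-simG-halt : ∀ q c → TM.δ Mg q (cellG (unpack c)) ≡ nothing →
    step (just (simG q)) c ≡ goto (rewind trackF) (pack (record (unpack c) { headG = true })) stay
  δ-simG-halt q c δ≡ rewrite δ≡ = refl

  setCellF : Cell Mf → Tracks → Tracks
  setCellF c r = record r { cellF = c }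

  setCellG : Cell Mg → Tracks → Tracks
  setCellG c r = record r { cellG = c }

  markHeadF markHeadG : Tracks → Tracks
  markHeadF r = record r { headF = true }
  markHeadG r = record r { headG = true }

  module SimulateF = Simulation Mf simF rewindG cellF setCellF markHeadF (λ _ _ → refl) (λ _ _ _ → refl)
                                δ-simF-step δ-simF-halt
  module SimulateG = Simulation Mg simG (rewind trackF) cellG setCellG markHeadG (λ _ _ → refl) (λ _ _ _ → refl)
                                δ-simG-step δ-simG-halt

  tracksAfterF : Word k → Tape (Cell Mf) → ℕ → ℕ → Tracks
  tracksAfterF x hF pF i = tracks (hF i) (inputTape x i) (i ≡ᵇ 0) (i ≡ᵇ pF) false false false

  tracksAfterG : Tape (Cell Mf) → Tape (Cell Mg) → ℕ → ℕ → ℕ → Tracks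
  tracksAfterG hF hG pF pG i = tracks (hF i) (hG i) (i ≡ᵇ 0) (i ≡ᵇ pF) (i ≡ᵇ pG) false false

  tracksAfterF-write : ∀ x hF pF →
    (λ i → record (encodedInput x i) { cellF = hF i })
      [ pF ]≔ record (encodedInput x pF) { cellF = hF pF ; headF = true }
    ≗ tracksAfterF x hF pF
  tracksAfterF-write x hF pF = flag-write (λ i b → tracks (hF i) (inputTape x i) (i ≡ᵇ 0) b false false false) pF

  tracksAfterG-write : ∀ x hF hG pF pG →
    (λ i → record (tracksAfterF x hF pF i) { cellG = hG i })
      [ pG ]≔ record (tracksAfterF x hF pF pG) { cellG = hG pG ; headG = true }
    ≗ tracksAfterG hF hG pF pG
  tracksAfterG-write x hF hG pF pG = flag-write (λ i b → tracks (hF i) (hG i) (i ≡ᵇ 0) (i ≡ᵇ pF) b false false) pG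

  record Simulated (x : Word k) (hF : Tape (Cell Mf)) (hG : Tape (Cell Mg)) (pF pG tF tG : ℕ) : Set where
    field
      {end time} : ℕ
      {tape} : Tape HCell
      runs : Runs (just (simF zero)) (encodedTape x) 0 (just (rewind trackF)) tape pG time
      tracks≡ : ∀ i → unpack (tape i) ≡ tracksAfterG hF hG pF pG i
      used : UsedRegion tape end
      pF<end : pF < end
      pG<end : pG < end
      end≤ : end ≤ width x + tF + tG + 2
      time≤ : time ≤ tF + tG + (width x + tF + 3)

  simulate-both : ∀ x {qF hF pF tF qG hG pG tG} →
    SimulateF.SM.Runs zero (inputTape x) 0 qF hF pF tF → TM.δ Mf qF (hF pF) ≡ nothing →
    SimulateG.SM.Runs zero (inputTape x) 0 qG hG pG tG → TM.δ Mg qG (hG pG) ≡ nothing →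
    Simulated x hF hG pF pG tF tG
  simulate-both x {hF = hF} {pF} {tF} {hG = hG} {pG} {tG} runsF haltsF runsG haltsG
    with SimulateF.simulate-to-halt runsF haltsF (encodedTape x) (encodedInput x) (width x)
           (unpack-encodedTape x) (encodedTape-used x) z≤n
  ... | h₁ , E₁ , runs₁ , tracks₁ , used₁ , pF<E₁ , E₁≤ , _
    with SimulateG.simulate-to-halt runsG haltsG h₁ (tracksAfterF x hF pF) E₁
           (λ i → trans (tracks₁ i) (tracksAfterF-write x hF pF i)) used₁ z≤n
  ... | h₂ , E₂ , runs₂ , tracks₂ , used₂ , pG<E₂ , E₂≤ , E₁≤E₂ = record
    { runs = runs₁ ⨾ rewind-runs (λ _ → refl) h₁ pF leftEnd₁ ⨾ runs₂
    ; tracks≡ = λ i → trans (tracks₂ i) (tracksAfterG-write x hF hG pF pG i)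
    ; used = used₂
    ; pF<end = <-≤-trans pF<E₁ E₁≤E₂
    ; pG<end = pG<E₂
    ; end≤ = ≤-trans E₂≤ (≤-trans (s≤s (+-monoˡ-≤ tG E₁≤)) (≤-reflexive (plus-two (width x) tF tG)))
    ; time≤ = ≤-trans (≤-reflexive (count tF pF tG))
                      (+-monoʳ-≤ (tF + tG) (+-monoˡ-≤ 3 (≤-pred (≤-trans pF<E₁ E₁≤))))
    }
    where
    leftEnd₁ : LeftEndAt0 (unpack ∘ h₁)
    leftEnd₁ = trans (cong leftEnd (tracks₁ 0)) (cong leftEnd (tracksAfterF-write x hF pF 0)) ,
               λ i → trans (cong leftEnd (tracks₁ (suc i))) (cong leftEnd (tracksAfterF-write x hF pF (suc i)))
    plus-two : ∀ w a b → suc (suc (w + a) + b) ≡ w + a + b + 2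
    plus-two = solve-∀
    count : ∀ a p b → a + 1 + (p + 1 + (b + 1)) ≡ a + b + (p + 3)
    count = solve-∀

  packed-nonBlank : ∀ {c} → IsPacked c → c ≢ nothing
  packed-nonBlank (_ , refl) ()

  Written : Tape HCell → ℕ → Word k → Set
  Written h p [] = ∀ j → h (j + p) ≡ nothing
  Written h p (a ∷ O) = h p ≡ inputCell a × Written h (suc p) O

  written-beyond : ∀ O {h p} → Written h p O → ∀ j → h (j + (length O + p)) ≡ nothing
  written-beyond [] blanks j = blanks j
  written-beyond (a ∷ O) {h} {p} (_ , rest) j =
    trans (cong (λ y → h (j + y)) (sym (+-suc (length O) p))) (written-beyond O rest j)

  written-symbol : ∀ O {h p} j → Written h p O → j < length O → Σ (Sym k) λ b → h (j + p) ≡ inputCell b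
  written-symbol (a ∷ O) zero (e , _) _ = a , e
  written-symbol (a ∷ O) {h} {p} (suc j) (_ , rest) (s≤s j<O) with written-symbol O j rest j<O
  ... | b , e = b , trans (cong h (sym (+-suc j p))) e

  written-snoc : ∀ O {h p q} a → q ≡ length O + p → Written h p O → Written (h [ q ]≔ inputCell a) p (O ++ a ∷ [])
  written-snoc [] {h} {p} a refl blanks =
    []≔-same h p _ ,
    λ j → trans ([]≔-other h _ (>⇒≢ (m≤n+m (suc p) j))) (trans (cong h (+-suc j p)) (blanks (suc j)))
  written-snoc (b ∷ O) {h} {p} a q≡ (e , rest) =
    trans ([]≔-other h _ (<⇒≢ (≤-trans (s≤s (m≤n+m p (length O))) (≤-reflexive (sym q≡))))) e ,
    written-snoc O a (trans q≡ (sym (+-suc (length O) p))) rest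

  written-below : ∀ O {h p q} c → q < p → Written h p O → Written (h [ q ]≔ c) p O
  written-below [] {h} {p} c q<p blanks j = trans ([]≔-other h c (>⇒≢ (≤-trans q<p (m≤n+m p j)))) (blanks j)
  written-below (b ∷ O) {h} {p} c q<p (e , rest) =
    trans ([]≔-other h c (>⇒≢ q<p)) e , written-below O c (≤-trans q<p (n≤1+n p)) rest

  written-output : ∀ O {h p} → Written h p O → Output h p O
  written-output [] blanks rewrite blanks 0 = blank
  written-output (a ∷ O) (e , rest) = e , written-output O rest

  nonBlank-before-end : ∀ {h E} O → PackedBelow h E → Written h E O → ∀ i → i < E + length O → h i ≢ nothing
  nonBlank-before-end {h} {E} O packed written i i<end with <-≤-connex i E
  ... | inj₁ i<E = packed-nonBlank (packed i i<E)
  ... | inj₂ E≤i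
    with written-symbol O (i ∸ E) written (subst (i ∸ E <_) (m+n∸m≡n E (length O)) (∸-monoˡ-< i<end E≤i))
  ...   | b , e rewrite m∸n+n≡m E≤i = λ blank≡ → symbol≢blank (trans (sym e) blank≡)
    where
    symbol≢blank : inputCell b ≢ nothing
    symbol≢blank ()

  write-symbol-unpack : ∀ h q a → h q ≡ nothing → ∀ i → unpack ((h [ q ]≔ inputCell a) i) ≡ unpack (h i)
  write-symbol-unpack h q a blank≡ i with i ℕ.≟ q
  ... | yes refl rewrite blank≡ = refl
  ... | no _ = refl

  write-beyond-packed : ∀ h E q c → E ≤ q → PackedBelow h E → PackedBelow (h [ q ]≔ c) E
  write-beyond-packed h E q c E≤q packed i i<E =
    subst IsPacked (sym ([]≔-other h c (<⇒≢ (<-≤-trans i<E E≤q)))) (packed i i<E)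

  copies : Track → Word k → Word k
  copies t = concatMap (copiesOf t)

  unmark : Track → Tracks → Tracks
  unmark trackF r = record r { doneF = false }
  unmark trackG r = record r { doneG = false }

  unmark-markDone : ∀ t r → unmark t (markDone t r) ≡ unmark t r
  unmark-markDone trackF r = refl
  unmark-markDone trackG r = refl

  leftEnd-markDone : ∀ t r → leftEnd (markDone t r) ≡ leftEnd r
  leftEnd-markDone trackF r = refl
  leftEnd-markDone trackG r = refl

  headOn-markDone : ∀ t r → headOn t (markDone t r) ≡ headOn t r
  headOn-markDone trackF r = refl
  headOn-markDone trackG r = refl

  symbolOn-markDone : ∀ t r → symbolOn t (markDone t r) ≡ symbolOn t r
  symbolOn-markDone trackF r = refl
  symbolOn-markDone trackG r = refl

  doneOn-markDone : ∀ t r → doneOn t (markDone t r) ≡ true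
  doneOn-markDone trackF r = refl
  doneOn-markDone trackG r = refl

  TrackOutput : Track → (ℕ → Tracks) → ℕ → Word k → Set
  TrackOutput t D p [] = symbolOn t (D p) ≡ nothing
  TrackOutput t D p (a ∷ v) = symbolOn t (D p) ≡ just a × TrackOutput t D (suc p) v

  trackOutput-cong : ∀ t {D D'} p v → (∀ i → symbolOn t (D' i) ≡ symbolOn t (D i)) →
    TrackOutput t D p v → TrackOutput t D' p v
  trackOutput-cong t p [] D'≗D out = trans (D'≗D p) out
  trackOutput-cong t p (a ∷ v) D'≗D (e , out) = trans (D'≗D p) e , trackOutput-cong t (suc p) v D'≗D out

  trackOutput-length : ∀ t D E p w → p ≤ E → TrackOutput t D p w → (∀ i → E ≤ i → symbolOn t (D i) ≡ nothing) →
    p + length w ≤ E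
  trackOutput-length t D E p [] p≤E _ _ = subst (_≤ E) (sym (+-identityʳ p)) p≤E
  trackOutput-length t D E p (a ∷ w) p≤E (e , out) beyond with <-≤-connex p E
  ... | inj₁ p<E = subst (_≤ E) (sym (+-suc p (length w))) (trackOutput-length t D E (suc p) w p<E out beyond)
  ... | inj₂ E≤p with trans (sym e) (beyond p E≤p)
  ...   | ()

  output⇒trackOutput : ∀ {B : Set} t (D : ℕ → Tracks) (h : Tape (Maybe (Sym k ⊎ B))) p w →
    (∀ i → symbolOn t (D i) ≡ inputSymbol (h i)) → Output h p w → TrackOutput t D p w
  output⇒trackOutput t D h p [] D≗h ni = trans (D≗h p) (nonInput-inputSymbol ni)
  output⇒trackOutput t D h p (a ∷ w) D≗h (e , out) =
    trans (D≗h p) (cong inputSymbol e) , output⇒trackOutput t D h (suc p) w D≗h out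

  -- The first n cells of track t from its head position P are already copied; v is still to be copied.
  record CopyState (t : Track) (D : ℕ → Tracks) (P n : ℕ) (v : Word k) : Set where
    field
      leftEndAt0 : LeftEndAt0 D
      headBefore : ∀ i → i < P → headOn t (D i) ≡ false
      headAt : headOn t (D P) ≡ true
      copied : ∀ j → j < n → doneOn t (D (P + j)) ≡ true
      uncopied : ∀ j → doneOn t (D (P + n + j)) ≡ false
      remaining : TrackOutput t D (P + n) v

  copyState-cong : ∀ {t D D' P n v} → D' ≗ D → CopyState t D P n v → CopyState t D' P n v
  copyState-cong {t} {P = P} {v = v} D'≗D cs = record
    { leftEndAt0 = trans (cong leftEnd (D'≗D 0)) (proj₁ leftEndAt0) ,
                   λ i → trans (cong leftEnd (D'≗D (suc i))) (proj₂ leftEndAt0 i)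
    ; headBefore = λ i i<P → trans (cong (headOn t) (D'≗D i)) (headBefore i i<P)
    ; headAt = trans (cong (headOn t) (D'≗D P)) headAt
    ; copied = λ j j<n → trans (cong (doneOn t) (D'≗D _)) (copied j j<n)
    ; uncopied = λ j → trans (cong (doneOn t) (D'≗D _)) (uncopied j)
    ; remaining = trackOutput-cong t _ v (λ i → cong (symbolOn t) (D'≗D i)) remaining }
    where open CopyState cs

  copyState-mark : ∀ {t D P n a v} → CopyState t D P n (a ∷ v) →
    CopyState t (D [ P + n ]≔ markDone t (D (P + n))) P (suc n) v
  copyState-mark {t} {D} {P} {n} {a} {v} cs = record
    { leftEndAt0 = trans (kept leftEnd (leftEnd-markDone t) 0) (proj₁ leftEndAt0) ,
                   λ i → trans (kept leftEnd (leftEnd-markDone t) (suc i)) (proj₂ leftEndAt0 i)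
    ; headBefore = λ i i<P → trans (kept (headOn t) (headOn-markDone t) i) (headBefore i i<P)
    ; headAt = trans (kept (headOn t) (headOn-markDone t) P) headAt
    ; copied = copied'
    ; uncopied = λ j → trans (cong (doneOn t) ([]≔-other D _ (>⇒≢ (after j))))
                             (trans (cong (λ i → doneOn t (D i)) (shift j)) (uncopied (suc j)))
    ; remaining = subst (λ p → TrackOutput t D' p v) (sym (+-suc P n))
                    (trackOutput-cong t _ v (kept (symbolOn t) (symbolOn-markDone t)) (proj₂ remaining)) }
    where
    open CopyState cs
    D' = D [ P + n ]≔ markDone t (D (P + n))
    kept : ∀ {X : Set} (g : Tracks → X) → (∀ r → g (markDone t r) ≡ g r) → ∀ i → g (D' i) ≡ g (D i)
    kept g g-kept = []≔-preserves g (markDone t) g-kept D (P + n)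
    shift : ∀ j → P + suc n + j ≡ P + n + suc j
    shift j = trans (cong (_+ j) (+-suc P n)) (sym (+-suc (P + n) j))
    after : ∀ j → P + n < P + suc n + j
    after j = ≤-trans (≤-reflexive (sym (+-suc P n))) (m≤m+n (P + suc n) j)
    copied' : ∀ j → j < suc n → doneOn t (D' (P + j)) ≡ true
    copied' j j<1+n with m≤n⇒m<n∨m≡n (≤-pred j<1+n)
    ... | inj₁ j<n = trans (cong (doneOn t) ([]≔-other D _ (<⇒≢ (+-monoʳ-< P j<n)))) (copied j j<n)
    ... | inj₂ refl = trans (cong (doneOn t) ([]≔-same D (P + j) _)) (doneOn-markDone t _)

  δ-findHead-move : ∀ t c → headOn t (unpack c) ≡ false → step (just (findHead t)) c ≡ goto (findHead t) c moveR
  δ-findHead-move t c e rewrite e = refl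

  δ-findHead-arrive : ∀ t c → headOn t (unpack c) ≡ true → step (just (findHead t)) c ≡ goto (skipCopied t) c stay
  δ-findHead-arrive t c e rewrite e = refl

  δ-skipCopied-copied : ∀ t c → doneOn t (unpack c) ≡ true → step (just (skipCopied t)) c ≡ goto (skipCopied t) c moveR
  δ-skipCopied-copied t c e rewrite e = refl

  δ-skipCopied-take : ∀ t c {a} → doneOn t (unpack c) ≡ false → symbolOn t (unpack c) ≡ just a →
    step (just (skipCopied t)) c ≡ goto (carry t a) (pack (markDone t (unpack c))) moveR
  δ-skipCopied-take t c e e' rewrite e | e' = refl

  δ-skipCopied-end : ∀ t c → doneOn t (unpack c) ≡ false → symbolOn t (unpack c) ≡ nothing →
    step (just (skipCopied t)) c ≡ goto (afterCopy t) c stay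
  δ-skipCopied-end t c e e' rewrite e | e' = refl

  δ-carry-move : ∀ t a c → c ≢ nothing → step (just (carry t a)) c ≡ goto (carry t a) c moveR
  δ-carry-move t a nothing c≢ = ⊥-elim (c≢ refl)
  δ-carry-move trackF a (just _) _ = refl
  δ-carry-move trackG a (just _) _ = refl

  δ-writeSep-move : ∀ c → c ≢ nothing → step (just writeSep) c ≡ goto writeSep c moveR
  δ-writeSep-move nothing c≢ = ⊥-elim (c≢ refl)
  δ-writeSep-move (just _) _ = refl

  δ-findOutput-move : ∀ c → IsPacked c → step (just findOutput) c ≡ goto findOutput c moveR
  δ-findOutput-move _ (_ , refl) = refl

  return-runs : ∀ {t P n v} h pos → CopyState t (unpack ∘ h) P n v →
    Runs (just (rewind t)) h pos (just (skipCopied t)) h (P + n) (pos + 1 + (P + suc n))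
  return-runs {t} {P} {n} h pos cs =
    rewind-runs (λ _ → refl) h pos leftEndAt0 ⨾
    sweepRight (just (findHead t)) P 0 h (λ j j<P → δ-findHead-move t (h j) (headBefore j j<P)) ⨾
    stay-runs (δ-findHead-arrive t (h P) headAt) ⨾
    sweepRight (just (skipCopied t)) n P h (λ j j<n → δ-skipCopied-copied t (h (P + j)) (copied j j<n))
    where open CopyState cs

  finish-runs : ∀ {t P n} h pos → CopyState t (unpack ∘ h) P n [] →
    Runs (just (rewind t)) h pos (just (afterCopy t)) h (P + n) (pos + 1 + (P + suc n) + 1)
  finish-runs {t} {P} {n} h pos cs =
    return-runs h pos cs ⨾
    stay-runs (δ-skipCopied-end t (h (P + n))
                 (subst (λ i → doneOn t (unpack (h i)) ≡ false) (+-identityʳ (P + n)) (uncopied 0)) remaining)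
    where open CopyState cs

  module Append (h : Tape HCell) (E : ℕ) (O : Word k) (packed : PackedBelow h E) (written : Written h E O) where
    end : ℕ
    end = E + length O

    blank-end : h end ≡ nothing
    blank-end = trans (cong h (+-comm E (length O))) (written-beyond O written 0)

    end≤ : ∀ w → end ≤ E + length (O ++ w)
    end≤ w = +-monoʳ-≤ E (≤-trans (m≤m+n (length O) (length w)) (≤-reflexive (sym (length-++ O))))

    module _ (a : Sym k) where
      tape₁ : Tape HCell
      tape₁ = h [ end ]≔ inputCell a

      written₁ : Written tape₁ E (O ++ a ∷ [])
      written₁ = written-snoc O a (+-comm E (length O)) written

      packed₁ : PackedBelow tape₁ E
      packed₁ = write-beyond-packed h E end _ (m≤m+n E _) packed

      unpack₁ : ∀ i → unpack (tape₁ i) ≡ unpack (h i)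
      unpack₁ = write-symbol-unpack h end a blank-end

  module Append₂ (h : Tape HCell) (E : ℕ) (O : Word k) (packed : PackedBelow h E) (written : Written h E O)
                 (a b : Sym k) where
    open Append h E O packed written public
    private
      module A = Append (tape₁ a) E (O ++ a ∷ []) (packed₁ a) (written₁ a)
      end₁ : A.end ≡ suc end
      end₁ = trans (cong (E +_) (trans (length-++ O) (+-comm (length O) 1))) (+-suc E (length O))

    tape₂ : Tape HCell
    tape₂ = tape₁ a [ suc end ]≔ inputCell b

    written₂ : Written tape₂ E (O ++ a ∷ b ∷ [])
    written₂ = subst₂ (λ p w → Written (tape₁ a [ p ]≔ inputCell b) E w) end₁ (++-assoc O (a ∷ []) (b ∷ []))
                      (A.written₁ b)

    packed₂ : PackedBelow tape₂ E
    packed₂ = subst (λ p → PackedBelow (tape₁ a [ p ]≔ inputCell b) E) end₁ (A.packed₁ b)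

    unpack₂ : ∀ i → unpack (tape₂ i) ≡ unpack (h i)
    unpack₂ i = trans (subst (λ p → unpack ((tape₁ a [ p ]≔ inputCell b) i) ≡ unpack (tape₁ a i)) end₁
                             (A.unpack₁ b i))
                      (unpack₁ a i)

  deposit : ∀ t a h E O → PackedBelow h E → Written h E O →
    Σ (Tape HCell) λ h' → Σ ℕ λ pos' → Σ ℕ λ st →
      Runs (just (carry t a)) h (E + length O) (just (rewind t)) h' pos' st × st ≤ 2 ×
      Written h' E (O ++ copiesOf t a) × PackedBelow h' E × pos' ≤ E + length (O ++ copiesOf t a) ×
      (∀ i → unpack (h' i) ≡ unpack (h i))
  deposit trackF a h E O packed written =
    tape₂ , end , 2 , more carry-end (step-runs refl) , ≤-refl , written₂ , packed₂ , end≤ (a ∷ a ∷ []) , unpack₂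
    where
    open Append₂ h E O packed written a a
    carry-end : step (just (carry trackF a)) (h end) ≡ goto (carryTwin a) (inputCell a) moveR
    carry-end rewrite blank-end = refl
  deposit trackG a h E O packed written =
    tape₁ a , pred end , 1 , step-runs carry-end , s≤s z≤n ,
    written₁ a , packed₁ a , ≤-trans pred[n]≤n (end≤ (a ∷ [])) , unpack₁ a
    where
    open Append h E O packed written
    carry-end : step (just (carry trackG a)) (h end) ≡ goto (rewind trackG) (inputCell a) moveL
    carry-end rewrite blank-end = refl

  write-separator : ∀ h E O q packed written → q ≤ E →
    Runs (just writeSep) h q (just (rewind trackG)) (Append₂.tape₂ h E O packed written zero (suc zero))
         (E + length O) ((E + length O ∸ q) + 2)
  write-separator h E O q packed written q≤E = sweep ⨾ more sep-end (step-runs refl)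
    where
    open Append h E O packed written
    q≤end : q ≤ end
    q≤end = ≤-trans q≤E (m≤m+n E _)
    sweep : Runs (just writeSep) h q (just writeSep) h end (end ∸ q)
    sweep = subst (λ p → Runs (just writeSep) h q (just writeSep) h p (end ∸ q)) (m+[n∸m]≡n q≤end)
      (sweepRight (just writeSep) (end ∸ q) q h λ j j<d → δ-writeSep-move (h (q + j))
        (nonBlank-before-end O packed written (q + j) (subst (q + j <_) (m+[n∸m]≡n q≤end) (+-monoʳ-< q j<d))))
    sep-end : step (just writeSep) (h end) ≡ goto writeSep₂ (inputCell zero) moveR
    sep-end rewrite blank-end = refl

  find-output : ∀ h E q → PackedBelow h E → q ≤ E → Runs (just findOutput) h q (just findOutput) h E (E ∸ q)
  find-output h E q packed q≤E =
    subst (λ p → Runs (just findOutput) h q (just findOutput) h p (E ∸ q)) (m+[n∸m]≡n q≤E)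
      (sweepRight (just findOutput) (E ∸ q) q h λ j j<d → δ-findOutput-move (h (q + j))
        (packed (q + j) (subst (q + j <_) (m+[n∸m]≡n q≤E) (+-monoʳ-< q j<d))))

  copy-symbol : ∀ t {P n a v} h E O pos → CopyState t (unpack ∘ h) P n (a ∷ v) → PackedBelow h E → Written h E O →
    P + n < E → pos ≤ E + length O →
    Σ (Tape HCell) λ h' → Σ ℕ λ pos' → Σ ℕ λ st →
      Runs (just (rewind t)) h pos (just (rewind t)) h' pos' st ×
      (unpack ∘ h' ≗ (unpack ∘ h) [ P + n ]≔ markDone t (unpack (h (P + n)))) ×
      PackedBelow h' E × Written h' E (O ++ copiesOf t a) × pos' ≤ E + length (O ++ copiesOf t a) ×
      st ≤ 2 * (E + length O) + 4
  copy-symbol t {P} {n} {a} h E O pos cs packed written q<E pos≤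
    with deposit t a (h [ P + n ]≔ pack (markDone t (unpack (h (P + n))))) E O
           (write-packed h E (P + n) _ packed) (written-below O _ q<E written)
  ... | h' , pos' , st , deposited , st≤2 , written' , packed' , pos'≤ , unpack≡ =
    h' , pos' , _ , return-runs h pos cs ⨾ more take (carry-sweep ⨾ deposited) ,
    (λ i → trans (unpack≡ i) (marked i)) , packed' , written' , pos'≤ , time≤
    where
    open CopyState cs
    q = P + n
    e = E + length O
    hm = h [ q ]≔ pack (markDone t (unpack (h q)))
    q<e : q < e
    q<e = ≤-trans q<E (m≤m+n E _)
    d = e ∸ suc q
    take : step (just (skipCopied t)) (h q) ≡ goto (carry t a) (pack (markDone t (unpack (h q)))) moveR
    take = δ-skipCopied-take t (h q) (subst (λ i → doneOn t (unpack (h i)) ≡ false) (+-identityʳ q) (uncopied 0))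
                                      (proj₁ remaining)
    nonBlank : ∀ j → j < d → hm (suc q + j) ≢ nothing
    nonBlank j j<d rewrite []≔-other h (pack (markDone t (unpack (h q)))) (>⇒≢ (s≤s (m≤m+n q j))) =
      nonBlank-before-end O packed written (suc q + j) (subst (suc q + j <_) (m+[n∸m]≡n q<e) (+-monoʳ-< (suc q) j<d))
    carry-sweep : Runs (just (carry t a)) hm (suc q) (just (carry t a)) hm e d
    carry-sweep = subst (λ p → Runs (just (carry t a)) hm (suc q) (just (carry t a)) hm p d) (m+[n∸m]≡n q<e)
      (sweepRight (just (carry t a)) d (suc q) hm λ j j<d → δ-carry-move t a (hm (suc q + j)) (nonBlank j j<d))
    marked : ∀ i → unpack (hm i) ≡ ((unpack ∘ h) [ q ]≔ markDone t (unpack (h q))) i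
    marked i with i ℕ.≟ q
    ... | yes _ = unpack-pack _
    ... | no _ = refl
    regroup : ∀ pos P n d s → pos + 1 + (P + suc n) + suc (d + s) ≡ pos + (suc (P + n) + d) + (2 + s)
    regroup = solve-∀
    double : ∀ e → e + e + (2 + 2) ≡ 2 * e + 4
    double = solve-∀
    time≤ : pos + 1 + (P + suc n) + suc (d + st) ≤ 2 * e + 4
    time≤ = begin
      pos + 1 + (P + suc n) + suc (d + st) ≡⟨ regroup pos P n d st ⟩
      pos + (suc q + d) + (2 + st)         ≡⟨ cong (λ y → pos + y + (2 + st)) (m+[n∸m]≡n q<e) ⟩
      pos + e + (2 + st)                   ≤⟨ +-mono-≤ (+-monoˡ-≤ e pos≤) (+-monoʳ-≤ 2 st≤2) ⟩
      e + e + (2 + 2)                      ≡⟨ double e ⟩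
      2 * e + 4                            ∎
      where open ≤-Reasoning

  record CopyRun (t : Track) (h : Tape HCell) (pos E : ℕ) (O : Word k) (P n : ℕ) (v : Word k) : Set where
    field
      {tape} : Tape HCell
      {pos' time} : ℕ
      runs : Runs (just (rewind t)) h pos (just (rewind t)) tape pos' time
      state : CopyState t (unpack ∘ tape) P (n + length v) []
      packed : PackedBelow tape E
      written : Written tape E (O ++ copies t v)
      pos'≤ : pos' ≤ E + length (O ++ copies t v)
      unmarked : ∀ i → unmark t (unpack (tape i)) ≡ unmark t (unpack (h i))
      time≤ : time ≤ length v * (2 * (E + length (O ++ copies t v)) + 4)

  copy-track : ∀ t {P n} v h E O pos → CopyState t (unpack ∘ h) P n v → PackedBelow h E → Written h E O →
    P + n + length v ≤ E → pos ≤ E + length O → CopyRun t h pos E O P n v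
  copy-track t {n = n} [] h E O pos cs packed written _ pos≤ = record
    { runs = done (λ _ → refl)
    ; state = subst (λ m → CopyState t (unpack ∘ h) _ m []) (sym (+-identityʳ n)) cs
    ; packed = packed
    ; written = subst (Written h E) (sym (++-identityʳ O)) written
    ; pos'≤ = subst (λ w → pos ≤ E + length w) (sym (++-identityʳ O)) pos≤
    ; unmarked = λ _ → refl
    ; time≤ = z≤n }
  copy-track t {P} {n} (a ∷ v) h E O pos cs packed written fits pos≤
    with copy-symbol t h E O pos cs packed written (<-≤-trans (m<m+n (P + n) (s≤s z≤n)) fits) pos≤
  ... | h₁ , pos₁ , st₁ , runs₁ , marked₁ , packed₁ , written₁ , pos₁≤ , st₁≤ = record
    { runs = runs₁ ⨾ R.runs
    ; state = subst (λ m → CopyState t (unpack ∘ R.tape) P m []) (sym (+-suc n (length v))) R.state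
    ; packed = R.packed
    ; written = subst (Written R.tape E) assoc R.written
    ; pos'≤ = subst (λ w → R.pos' ≤ E + length w) assoc R.pos'≤
    ; unmarked = λ i → trans (R.unmarked i) (trans (cong (unmark t) (marked₁ i))
                               ([]≔-preserves (unmark t) (markDone t) (unmark-markDone t) (unpack ∘ h) (P + n) i))
    ; time≤ = +-mono-≤ (≤-trans st₁≤ (+-monoˡ-≤ 4 (*-monoʳ-≤ 2 (+-monoʳ-≤ E O≤))))
                       (subst (λ w → R.time ≤ length v * (2 * (E + length w) + 4)) assoc R.time≤) }
    where
    assoc : (O ++ copiesOf t a) ++ copies t v ≡ O ++ copies t (a ∷ v)
    assoc = ++-assoc O (copiesOf t a) (copies t v)
    O≤ : length O ≤ length (O ++ copies t (a ∷ v))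
    O≤ = ≤-trans (m≤m+n (length O) _) (≤-reflexive (sym (length-++ O)))
    fits' : P + suc n + length v ≤ E
    fits' = subst (_≤ E) (trans (+-suc (P + n) (length v)) (cong (_+ length v) (sym (+-suc P n)))) fits
    module R = CopyRun (copy-track t v h₁ E (O ++ copiesOf t a) pos₁ (copyState-cong marked₁ (copyState-mark cs))
                             packed₁ written₁ fits' pos₁≤)

  copies-trackG : ∀ v → copies trackG v ≡ v
  copies-trackG [] = refl
  copies-trackG (a ∷ v) = cong (a ∷_) (copies-trackG v)

  length-copies-trackF : ∀ v → length (copies trackF v) ≡ length v + length v
  length-copies-trackF [] = refl
  length-copies-trackF (a ∷ v) = cong suc (trans (cong suc (length-copies-trackF v)) (sym (+-suc (length v) (length v))))

  record HaltsWith (s : Maybe St) (h : Tape HCell) (p : ℕ) (w : Word k) (bound : ℕ) : Set where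
    field
      {tape} : Tape HCell
      {pos time} : ℕ
      runs : Runs s h p (just findOutput) tape pos time
      halts : step (just findOutput) (tape pos) ≡ nothing
      output : Output tape pos w
      time≤ : time ≤ bound

  haltsWith-prepend : ∀ {s h p s' h' p' n w b} → Runs s h p s' h' p' n → HaltsWith s' h' p' w b →
    HaltsWith s h p w (n + b)
  haltsWith-prepend r H = record { runs = r ⨾ runs ; halts = halts ; output = output ; time≤ = +-monoʳ-≤ _ time≤ }
    where open HaltsWith H

  module CopyOutputs (x : Word k) {hF hG pF pG tF tG} (S : Simulated x hF hG pF pG tF tG)
                     (fx gx : Word k) (outF : Output hF pF fx) (outG : Output hG pG gx) where
    open Simulated S
    D = unpack ∘ tape
    E = end

    leftEndAt0 : LeftEndAt0 D
    leftEndAt0 = cong leftEnd (tracks≡ 0) , λ i → cong leftEnd (tracks≡ (suc i))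

    headF-before : ∀ i → i < pF → headF (D i) ≡ false
    headF-before i i<pF = trans (cong headF (tracks≡ i)) (dec-false (i ℕ.≟ pF) (<⇒≢ i<pF))

    headG-before : ∀ i → i < pG → headG (D i) ≡ false
    headG-before i i<pG = trans (cong headG (tracks≡ i)) (dec-false (i ℕ.≟ pG) (<⇒≢ i<pG))

    outputF : TrackOutput trackF D pF fx
    outputF = output⇒trackOutput trackF D hF pF fx (λ i → cong (inputSymbol ∘ cellF) (tracks≡ i)) outF

    outputG : TrackOutput trackG D pG gx
    outputG = output⇒trackOutput trackG D hG pG gx (λ i → cong (inputSymbol ∘ cellG) (tracks≡ i)) outG

    fx-fits : pF + length fx ≤ E
    fx-fits = trackOutput-length trackF D E pF fx (<⇒≤ pF<end) outputF
                (λ i E≤i → cong (λ c → inputSymbol (cellF (unpack c))) (proj₂ used i E≤i))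

    gx-fits : pG + length gx ≤ E
    gx-fits = trackOutput-length trackG D E pG gx (<⇒≤ pG<end) outputG
                (λ i E≤i → cong (λ c → inputSymbol (cellG (unpack c))) (proj₂ used i E≤i))

    stateF : CopyState trackF D pF 0 fx
    stateF = record
      { leftEndAt0 = leftEndAt0
      ; headBefore = headF-before
      ; headAt = trans (cong headF (tracks≡ pF)) (dec-true (pF ℕ.≟ pF) refl)
      ; copied = λ _ ()
      ; uncopied = λ j → cong doneF (tracks≡ _)
      ; remaining = subst (λ p → TrackOutput trackF D p fx) (sym (+-identityʳ pF)) outputF }

    -- Copying f x changes only the done marks of the f-track, which the copy of g x never reads.
    stateG : ∀ h → (∀ i → unmark trackF (unpack (h i)) ≡ unmark trackF (D i)) →
      CopyState trackG (unpack ∘ h) pG 0 gx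
    stateG h kept = record
      { leftEndAt0 = trans (cong leftEnd (kept 0)) (proj₁ leftEndAt0) ,
                     λ i → trans (cong leftEnd (kept (suc i))) (proj₂ leftEndAt0 i)
      ; headBefore = λ i i<pG → trans (cong headG (kept i)) (headG-before i i<pG)
      ; headAt = trans (cong headG (kept pG)) (trans (cong headG (tracks≡ pG)) (dec-true (pG ℕ.≟ pG) refl))
      ; copied = λ _ ()
      ; uncopied = λ j → trans (cong doneG (kept _)) (cong doneG (tracks≡ _))
      ; remaining = trackOutput-cong trackG _ gx (λ i → cong (inputSymbol ∘ cellG) (kept i))
                      (subst (λ p → TrackOutput trackG D p gx) (sym (+-identityʳ pG)) outputG) }

    module RF = CopyRun (copy-track trackF fx tape E [] pG stateF (proj₁ used) (λ j → proj₂ used (j + E) (m≤n+m E j))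
                                    (subst (_≤ E) (cong (_+ length fx) (sym (+-identityʳ pF))) fx-fits)
                                    (≤-trans (<⇒≤ pG<end) (m≤m+n E 0)))

    dupF = copies trackF fx
    O₁ = dupF ++ zero ∷ suc zero ∷ []

    module Sep = Append₂ RF.tape E dupF RF.packed RF.written zero (suc zero)

    module RG = CopyRun (copy-track trackG gx Sep.tape₂ E O₁ (E + length dupF)
                                    (stateG Sep.tape₂ λ i → trans (cong (unmark trackF) (Sep.unpack₂ i)) (RF.unmarked i))
                                    Sep.packed₂ Sep.written₂
                                    (subst (_≤ E) (cong (_+ length gx) (sym (+-identityʳ pG))) gx-fits)
                                    (+-monoʳ-≤ E (≤-trans (m≤m+n (length dupF) 2) (≤-reflexive (sym (length-++ dupF))))))

    O₂ = O₁ ++ copies trackG gx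

    O₂≡ : O₂ ≡ ⟨ fx , gx ⟩
    O₂≡ = trans (++-assoc dupF (zero ∷ suc zero ∷ []) (copies trackG gx))
                (cong (λ w → dupF ++ zero ∷ suc zero ∷ w) (copies-trackG gx))

    runs-copy = RF.runs ⨾ finish-runs RF.tape RF.pos' RF.state ⨾
                write-separator RF.tape E dupF (pF + length fx) RF.packed RF.written fx-fits ⨾
                RG.runs ⨾ finish-runs RG.tape RG.pos' RG.state ⨾ find-output RG.tape E (pG + length gx) RG.packed gx-fits

    fx≤E : length fx ≤ E
    fx≤E = ≤-trans (m≤n+m _ pF) fx-fits

    gx≤E : length gx ≤ E
    gx≤E = ≤-trans (m≤n+m _ pG) gx-fits

    dupF≤ : length dupF ≤ E + E
    dupF≤ = ≤-trans (≤-reflexive (length-copies-trackF fx)) (+-mono-≤ fx≤E fx≤E)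

    O₂≤ : length O₂ ≤ E + E + 2 + E
    O₂≤ = ≤-trans (≤-reflexive (trans (length-++ O₁) (cong (_+ length (copies trackG gx)) (length-++ dupF))))
                  (+-mono-≤ (+-monoˡ-≤ 2 dupF≤) (≤-trans (≤-reflexive (cong length (copies-trackG gx))) gx≤E))

    copy-time : RF.time + (RF.pos' + 1 + (pF + suc (length fx)) + 1 + ((E + length dupF ∸ (pF + length fx)) + 2 +
                (RG.time + (RG.pos' + 1 + (pG + suc (length gx)) + 1 + (E ∸ (pG + length gx))))))
                ≤ copyTime E
    copy-time = begin
      RF.time + (RF.pos' + 1 + (pF + suc (length fx)) + 1 + ((E + length dupF ∸ (pF + length fx)) + 2 +
        (RG.time + (RG.pos' + 1 + (pG + suc (length gx)) + 1 + (E ∸ (pG + length gx))))))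
        ≤⟨ +-mono-≤ timeF (+-mono-≤ finishF (+-mono-≤ separate
             (+-mono-≤ timeG (+-mono-≤ finishG (m∸n≤m E (pG + length gx)))))) ⟩
      E * (2 * (E + (E + E)) + 4) + ((E + (E + E)) + 1 + (E + suc E) + 1 + ((E + (E + E)) + 2 +
        (E * (2 * (E + (E + E + 2 + E)) + 4) + ((E + (E + E + 2 + E)) + 1 + (E + suc E) + 1 + E))))
        ≤⟨ m≤m+n _ (2 * E * E + 5 * E + 6) ⟩
      _ ≡⟨ polynomial E ⟩
      copyTime E ∎
      where
      open ≤-Reasoning
      polynomial : ∀ E → E * (2 * (E + (E + E)) + 4) + ((E + (E + E)) + 1 + (E + suc E) + 1 + ((E + (E + E)) + 2 +
        (E * (2 * (E + (E + E + 2 + E)) + 4) + ((E + (E + E + 2 + E)) + 1 + (E + suc E) + 1 + E)))) +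
        (2 * E * E + 5 * E + 6) ≡ 16 * (suc E * suc E)
      polynomial = solve-∀
      pF≤E = <⇒≤ pF<end
      pG≤E = <⇒≤ pG<end
      timeF : RF.time ≤ E * (2 * (E + (E + E)) + 4)
      timeF = ≤-trans RF.time≤ (*-mono-≤ fx≤E (+-monoˡ-≤ 4 (*-monoʳ-≤ 2 (+-monoʳ-≤ E dupF≤))))
      finishF : RF.pos' + 1 + (pF + suc (length fx)) + 1 ≤ (E + (E + E)) + 1 + (E + suc E) + 1
      finishF = +-monoˡ-≤ 1 (+-mono-≤ (+-monoˡ-≤ 1 (≤-trans RF.pos'≤ (+-monoʳ-≤ E dupF≤)))
                                      (+-mono-≤ pF≤E (s≤s fx≤E)))
      separate : (E + length dupF ∸ (pF + length fx)) + 2 ≤ (E + (E + E)) + 2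
      separate = +-monoˡ-≤ 2 (≤-trans (m∸n≤m (E + length dupF) (pF + length fx)) (+-monoʳ-≤ E dupF≤))
      timeG : RG.time ≤ E * (2 * (E + (E + E + 2 + E)) + 4)
      timeG = ≤-trans RG.time≤ (*-mono-≤ gx≤E (+-monoˡ-≤ 4 (*-monoʳ-≤ 2 (+-monoʳ-≤ E O₂≤))))
      finishG : RG.pos' + 1 + (pG + suc (length gx)) + 1 ≤ (E + (E + E + 2 + E)) + 1 + (E + suc E) + 1
      finishG = +-monoˡ-≤ 1 (+-mono-≤ (+-monoˡ-≤ 1 (≤-trans RG.pos'≤ (+-monoʳ-≤ E O₂≤)))
                                      (+-mono-≤ pG≤E (s≤s gx≤E)))

    copy-outputs : HaltsWith (just (simF zero)) (encodedTape x) 0 ⟨ fx , gx ⟩ (time + copyTime E)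
    copy-outputs = record
      { runs = runs ⨾ runs-copy
      ; halts = halts
      ; output = subst (Output RG.tape E) O₂≡ (written-output O₂ RG.written)
      ; time≤ = +-monoʳ-≤ time copy-time }
      where
      nonempty : 0 < length O₂
      nonempty = subst (λ w → 0 < length w) (sym (++-assoc dupF (zero ∷ suc zero ∷ []) (copies trackG gx)))
                       (subst (0 <_) (sym (length-++ dupF)) (≤-trans (s≤s z≤n) (m≤n+m _ (length dupF))))
      halts : step (just findOutput) (RG.tape E) ≡ nothing
      halts with written-symbol O₂ 0 RG.written nonempty
      ... | b , e rewrite e = refl

  haltsWith⇒exec : ∀ x {w b} → HaltsWith nothing (inputTape x) 0 w b → ∀ fuel → b ≤ fuel →
    exec H fuel (initConfig H x) ≡ just w
  haltsWith⇒exec x {w} P fuel b≤fuel with HS.runs⇒exec (lift-runs runs) (initConfig H x) (HS.initConfig-represents x)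
                                         (trans (HS.initConfig-state x) (sym stateIndex-start)) (HS.initConfig-headPos x)
    where open HaltsWith P
  ... | z' , exec≡ , represents , state≡ , pos≡ =
    subst (λ t → exec H t (initConfig H x) ≡ just w) (m+[n∸m]≡n (≤-trans time≤ b≤fuel))
      (trans (exec≡ _) (HS.halted⇒exec z' tape w represents δ-halts
                                       (subst (λ p → Output tape p w) (sym pos≡) output) _))
    where
    open HaltsWith P
    δ-halts : TM.δ H (Config.state z') (tape (HS.headPos z')) ≡ nothing
    δ-halts rewrite state≡ | pos≡ | indexState-stateIndex (just findOutput) | halts = refl

  width≤ : ∀ x → width x ≤ suc (length x)
  width≤ [] = s≤s z≤n
  width≤ (_ ∷ x) = n≤1+n _

  pairing-exec : ∀ x {fx gx n₁ n₂} →
    exec Mf n₁ (initConfig Mf x) ≡ just fx → exec Mg n₂ (initConfig Mg x) ≡ just gx →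
    ∀ fuel → ⟦ pairingBound (con n₁) (con n₂) ⟧ (length x) ≤ fuel →
    exec H fuel (initConfig H x) ≡ just ⟨ fx , gx ⟩
  pairing-exec x {fx} {gx} {n₁} {n₂} execF execG fuel bound≤fuel =
    haltsWith⇒exec x (haltsWith-prepend (encode-input x) copy-outputs) fuel (≤-trans total≤ bound≤fuel)
    where
    module HF = SimulateF.SM.HaltsWithin (SimulateF.SM.exec-init⇒haltsWithin n₁ x execF)
    module HG = SimulateG.SM.HaltsWithin (SimulateG.SM.exec-init⇒haltsWithin n₂ x execG)
    S = simulate-both x HF.runs HF.halts HG.runs HG.halts
    open CopyOutputs x S fx gx HF.output HG.output using (copy-outputs)
    open Simulated S using (time; end; time≤; end≤)
    n = length x
    simulation≤ : time ≤ n₁ + n₂ + (suc n + n₁ + 3)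
    simulation≤ = ≤-trans time≤ (+-mono-≤ (+-mono-≤ HF.time≤ HG.time≤)
                                          (+-monoˡ-≤ 3 (+-mono-≤ (width≤ x) HF.time≤)))
    region≤ : end ≤ suc n + n₁ + n₂ + 2
    region≤ = ≤-trans end≤ (+-monoˡ-≤ 2 (+-mono-≤ (+-mono-≤ (width≤ x) HF.time≤) HG.time≤))
    total≤ : 2 * n + 1 + (time + copyTime end) ≤ ⟦ pairingBound (con n₁) (con n₂) ⟧ n
    total≤ = ≤-trans (≤-reflexive (sym (+-assoc (2 * n + 1) time (copyTime end))))
                     (+-mono-≤ (+-monoʳ-≤ (2 * n + 1) simulation≤) (copyTime-mono region≤))

pairing-polyTime : ∀ {k} {f g : Word k → Word k} → PolyTimeComputable f → PolyTimeComputable g →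
  PolyTimeComputable (λ x → ⟨ f x , g x ⟩)
pairing-polyTime {k} (Mf , cf , execF) (Mg , cg , execG) =
  H , c , λ x → pairing-exec x (within-timeBound {Mf} cf execF x) (within-timeBound {Mg} cg execG x)
                              _ (bounded (length x))
  where
  open PairingMachine Mf Mg using (H)
  open PairingRuns Mf Mg using (pairing-exec)
  c = proj₁ (polynomial-bounded (pairingBound (timeBound cf) (timeBound cg)))
  bounded = proj₂ (polynomial-bounded (pairingBound (timeBound cf) (timeBound cg)))
  within-timeBound : ∀ {M : TM k} {h : Word k → Word k} c →
    (∀ x → exec M (c * length x ^ c + c) (initConfig M x) ≡ just (h x)) →
    ∀ x → exec M (⟦ timeBound c ⟧ (length x)) (initConfig M x) ≡ just (h x)
  within-timeBound {M} {h} c exec≡ x =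
    subst (λ t → exec M t (initConfig M x) ≡ just (h x)) (sym (⟦timeBound⟧ c (length x))) (exec≡ x)

unpair-⟨⟩ : ∀ {k} (u v : Word k) → unpair ⟨ u , v ⟩ ≡ just (u , v)
unpair-⟨⟩ [] v = refl
unpair-⟨⟩ (a ∷ u) v with a Fin.≟ a
... | yes _ rewrite unpair-⟨⟩ u v = refl
... | no a≢a = ⊥-elim (a≢a refl)

Δ̃-⟨⟩ : ∀ {k} (C D : Lang k) u v → (C Δ̃ D) ⟨ u , v ⟩ ≡ C u xor D v
Δ̃-⟨⟩ C D u v rewrite unpair-⟨⟩ u v = refl

Δ-≤ₘᵖ-Δ̃ : ∀ {k} {C' D'} (C D : Lang k) → C' ≤ₘᵖ C → D' ≤ₘᵖ D → (C' Δ D') ≤ₘᵖ (C Δ̃ D)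
Δ-≤ₘᵖ-Δ̃ C D (f , f-polyTime , C'≡) (g , g-polyTime , D'≡) =
  (λ x → ⟨ f x , g x ⟩) , pairing-polyTime f-polyTime g-polyTime ,
  λ x → trans (cong₂ _xor_ (C'≡ x) (D'≡ x)) (sym (Δ̃-⟨⟩ C D (f x) (g x)))

≤ₘᵖ-respˡ : ∀ {k} {A A' B : Lang k} → (∀ x → A x ≡ A' x) → A' ≤ₘᵖ B → A ≤ₘᵖ B
≤ₘᵖ-respˡ A≡A' (f , f-polyTime , A'≡) = f , f-polyTime , λ x → trans (A≡A' x) (A'≡ x)

lemma2p2 : {k : ℕ} (𝒞 𝒟 : Class k) (C D : Lang k) →
    Complete 𝒞 C → Complete 𝒟 D → Hard (𝒞 𝚫 𝒟) (C Δ̃ D)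
lemma2p2 𝒞 𝒟 C D (_ , C-hard) (_ , D-hard) A (C' , D' , C'∈𝒞 , D'∈𝒟 , A≡) =
  ≤ₘᵖ-respˡ {B = C Δ̃ D} A≡ (Δ-≤ₘᵖ-Δ̃ C D (C-hard C' C'∈𝒞) (D-hard D' D'∈𝒟))
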